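{- Let $\mathbf{M}$ be a class of matroids that is closed under taking minors and under direct sums with a loop and with a coloop. Then ${\mathrm{spex}}(\mathbf{M})$ is closed under taking minors.
   Context: A matroid $N'$ is a parallel extension of $M'$ if $N'$ has an element $e$ lying in a 2-element circuit of $N'$ with $N'\setminus e=M'$; it is a series extension of $M'$ if $N'$ has an element $e$ lying in a 2-element cocircuit of $N'$ with $N'/e=M'$. ${\mathrm{spex}}(\mathbf{M})$ is the class of matroids obtained from members of $\mathbf{M}$ by finitely many series and parallel extensions (up to isomorphism). Closure under direct sums with a loop and a coloop means $M\oplus U_{0,1}$ and $M\oplus U_{1,1}$ lie in $\mathbf{M}$ whenever $M$ does. -}

module Defs where

open import Data.Nat using (ℕ; zero; suc; _<_)
open import Data.Bool using (Bool; true; false; if_then_else_)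
open import Data.Fin using (Fin)
open import Data.Fin.Subset using (Subset; Side; inside; outside; ⊥; ⁅_⁆; _∈_; _∉_; _⊆_; _⊂_; ∣_∣; ∁; _∪_)
open import Data.Fin.Permutation using (Permutation; _⟨$⟩ˡ_)
open import Data.Vec using (Vec; []; _∷_; insertAt; tabulate; lookup)
open import Data.Product using (Σ; ∃; _×_; _,_)
open import Relation.Binary.PropositionalEquality using (_≡_; _≢_)
open import Level using (Level) renaming (suc to lsuc)

-- A set system on the ground set Fin n, given by a (decidable, Bool-valued)
-- independence predicate on subsets.
SetSystem : ℕ → Set
SetSystem n = Subset n → Bool

Indep : ∀ {n} → SetSystem n → Subset n → Set
Indep I X = I X ≡ true

Dep : ∀ {n} → SetSystem n → Subset n → Set
Dep I X = I X ≡ false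

record IsMatroid {n : ℕ} (I : SetSystem n) : Set where
  field
    empty-indep : Indep I ⊥
    down-closed : ∀ X Y → X ⊆ Y → Indep I Y → Indep I X
    exchange    : ∀ X Y → Indep I X → Indep I Y → ∣ X ∣ < ∣ Y ∣ →
                  ∃ λ e → e ∈ Y × e ∉ X × Indep I (X ∪ ⁅ e ⁆)

IsBasis : ∀ {n} → SetSystem n → Subset n → Set
IsBasis I B = Indep I B × (∀ Y → Indep I Y → B ⊆ Y → Y ⊆ B)

-- The dual: X is coindependent iff X is disjoint from some basis.
-- (Prop-valued since it involves an existential.)
CoIndep : ∀ {n} → SetSystem n → Subset n → Set
CoIndep I X = ∃ λ B → IsBasis I B × X ⊆ ∁ B

IsCircuit : ∀ {n} → SetSystem n → Subset n → Set
IsCircuit I C = Dep I C × (∀ Y → Y ⊂ C → Indep I Y)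

IsCocircuit : ∀ {n} → SetSystem n → Subset n → Set
IsCocircuit I C = (CoIndep I C → Data.Empty.⊥) × (∀ Y → Y ⊂ C → CoIndep I Y)
  where import Data.Empty

InTwoCircuit : ∀ {n} → SetSystem n → Fin n → Set
InTwoCircuit I e = ∃ λ C → IsCircuit I C × e ∈ C × ∣ C ∣ ≡ 2

InTwoCocircuit : ∀ {n} → SetSystem n → Fin n → Set
InTwoCocircuit I e = ∃ λ C → IsCocircuit I C × e ∈ C × ∣ C ∣ ≡ 2

-- Deletion and contraction of an element e of Fin (suc n); the remaining
-- elements are relabelled by Fin n in order (insertAt re-inserts e).
_∖_ : ∀ {n} → SetSystem (suc n) → Fin (suc n) → SetSystem n
(I ∖ e) X = I (insertAt X e outside)

-- M / e: if e is a loop, M / e = M \ e; otherwise X is independent iff X ∪ e is.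
_／_ : ∀ {n} → SetSystem (suc n) → Fin (suc n) → SetSystem n
(I ／ e) X = if I ⁅ e ⁆ then I (insertAt X e inside) else I (insertAt X e outside)

-- Isomorphism: a bijection of ground sets carrying independent sets to
-- independent sets (σ ⟨$⟩ʳ i is the image of i).
image : ∀ {m n} → Permutation m n → Subset m → Subset n
image σ X = tabulate λ j → lookup X (σ ⟨$⟩ˡ j)

_≅_ : ∀ {m n} → SetSystem m → SetSystem n → Set
_≅_ {m} {n} I J = Σ (Permutation m n) λ σ → ∀ X → I X ≡ J (image σ X)

data Minor : ∀ {m n} → SetSystem m → SetSystem n → Set where
  iso : ∀ {m n} {N : SetSystem m} {M : SetSystem n} → N ≅ M → Minor N M
  del : ∀ {m n} {N : SetSystem m} {M : SetSystem (suc n)} (e : Fin (suc n)) →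
        Minor N (M ∖ e) → Minor N M
  con : ∀ {m n} {N : SetSystem m} {M : SetSystem (suc n)} (e : Fin (suc n)) →
        Minor N (M ／ e) → Minor N M

-- Direct sums with a loop (U_{0,1}) and a coloop (U_{1,1}); the new element
-- is placed first.
⊕loop : ∀ {n} → SetSystem n → SetSystem (suc n)
⊕loop I (inside  ∷ X) = false
⊕loop I (outside ∷ X) = I X

⊕coloop : ∀ {n} → SetSystem n → SetSystem (suc n)
⊕coloop I (_ ∷ X) = I X

Class : Set₁
Class = ∀ {n} → SetSystem n → Set

IsClassOfMatroids : Class → Set
IsClassOfMatroids 𝐌 = ∀ {n} (I : SetSystem n) → 𝐌 I → IsMatroid I

MinorClosed : Class → Set
MinorClosed 𝐌 = ∀ {m n} (N : SetSystem m) (M : SetSystem n) → Minor N M → 𝐌 M → 𝐌 N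

LoopColoopClosed : Class → Set
LoopColoopClosed 𝐌 = ∀ {n} (M : SetSystem n) → 𝐌 M → 𝐌 (⊕loop M) × 𝐌 (⊕coloop M)

data spex (𝐌 : Class) : ∀ {n} → SetSystem n → Set where
  base : ∀ {n} {M : SetSystem n} → 𝐌 M → spex 𝐌 M
  iso  : ∀ {m n} {N : SetSystem m} {M : SetSystem n} → N ≅ M → spex 𝐌 M → spex 𝐌 N
  par  : ∀ {n} {M : SetSystem n} (N : SetSystem (suc n)) (e : Fin (suc n)) →
         IsMatroid N → InTwoCircuit N e → (N ∖ e) ≅ M → spex 𝐌 M → spex 𝐌 N
  ser  : ∀ {n} {M : SetSystem n} (N : SetSystem (suc n)) (e : Fin (suc n)) →
         IsMatroid N → InTwoCocircuit N e → (N ／ e) ≅ M → spex 𝐌 M → spex 𝐌 N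

-- Up to relabelling, a matroid N with a two-element circuit {e, p} is the parallel extension
-- of N ∖ e at p, and one with a two-element cocircuit {e, s} is the series extension of N / e
-- at s: parallel elements can replace each other in independent sets, and since every basis
-- meets {e, s}, so can series elements. Hence spex(𝐌) is generated by extensions in a normal
-- position, with the new element 0 next to its partner 1. Deleting or contracting an element
-- of such an extension either undoes it, commutes with it, or yields a smaller matroid plus a
-- loop or coloop (also the fate of an extension whose partner became a loop, resp. coloop, in a
-- minor). Adding a loop or coloop commutes with extensions and preserves 𝐌, so induction on the
-- normal form shows that minors stay in spex(𝐌).

module Submission where

open import Defs
open import Data.Nat as ℕ using (zero; suc; _<_; _≤_; z≤n; s≤s)
import Data.Nat.Properties as ℕP
open import Data.Bool using (Bool; true; false; if_then_else_; _∨_; not)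
import Data.Bool as Bool
import Data.Bool.Properties as BoolP
open import Data.Fin as Fin using (Fin; zero; suc; punchIn; punchOut)
import Data.Fin.Properties as FinP
open import Data.Fin.Subset using (Subset; Side; inside; outside; ⁅_⁆; _∈_; _∉_; _⊆_; _⊂_; ∣_∣; ∁; _∪_) renaming (⊥ to ∅)
import Data.Fin.Subset.Properties as SubsetP
open import Data.Fin.Permutation using (Permutation; _⟨$⟩ˡ_; _⟨$⟩ʳ_; inverseˡ; inverseʳ; permutation; remove; lift₀; flip)
import Data.Fin.Permutation as Perm
open import Data.Vec using (Vec; []; _∷_; insertAt; removeAt; tabulate; lookup; _[_]≔_)
import Data.Vec.Properties as VecP
open import Data.Product using (∃; _×_; _,_; proj₁; proj₂)
open import Data.Sum using (_⊎_; inj₁; inj₂)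
import Data.Sum
open import Data.Empty renaming (⊥ to ⊥e) using (⊥-elim)
open import Relation.Nullary using (¬_; yes; no; does)
open import Relation.Nullary.Decidable using (_×-dec_)
open import Relation.Binary.PropositionalEquality using (_≡_; _≢_; refl; sym; trans; cong; cong₂; subst; subst₂)

-- Subsets as Boolean vectors

In : ∀ {n} → Subset n → Fin n → Set
In X i = lookup X i ≡ inside

Out : ∀ {n} → Subset n → Fin n → Set
Out X i = lookup X i ≡ outside

true≢false : true ≢ false
true≢false ()

in-and-out : ∀ {b : Bool} → b ≡ true → b ≡ false → ⊥e
in-and-out refl ()

Bool-ext : ∀ {a b : Bool} → (a ≡ true → b ≡ true) → (b ≡ true → a ≡ true) → a ≡ b
Bool-ext {true}  {true}  f g = refl
Bool-ext {true}  {false} f g = ⊥-elim (true≢false (sym (f refl)))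
Bool-ext {false} {true}  f g = g refl
Bool-ext {false} {false} f g = refl

lookup-ext : ∀ {a} {A : Set a} {n} (X Y : Vec A n) → (∀ i → lookup X i ≡ lookup Y i) → X ≡ Y
lookup-ext []      []      h = refl
lookup-ext (x ∷ X) (y ∷ Y) h = cong₂ _∷_ (h zero) (lookup-ext X Y (λ i → h (suc i)))

¬In⇒Out : ∀ {n} {X : Subset n} {i} → ¬ In X i → Out X i
¬In⇒Out {X = X} {i} h with lookup X i
... | true  = ⊥-elim (h refl)
... | false = refl

In⇒∈ : ∀ {n} {X : Subset n} {i} → In X i → i ∈ X
In⇒∈ {X = X} {i} h = VecP.lookup⇒[]= i X h

∈⇒In : ∀ {n} {X : Subset n} {i} → i ∈ X → In X i
∈⇒In = VecP.[]=⇒lookup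

Out⇒∉ : ∀ {n} {X : Subset n} {i} → Out X i → i ∉ X
Out⇒∉ o x∈X = in-and-out (∈⇒In x∈X) o

mk⊆ : ∀ {n} {X Y : Subset n} → (∀ i → In X i → In Y i) → X ⊆ Y
mk⊆ h {x} p = In⇒∈ (h x (∈⇒In p))

use⊆ : ∀ {n} {X Y : Subset n} → X ⊆ Y → ∀ i → In X i → In Y i
use⊆ h i p = ∈⇒In (h (In⇒∈ p))

lookup-∅ : ∀ {n} (i : Fin n) → Out ∅ i
lookup-∅ i = VecP.lookup-replicate i outside

In-⁅⁆ : ∀ {n} {e i : Fin n} → In ⁅ e ⁆ i → i ≡ e
In-⁅⁆ {e = e} h = SubsetP.x∈⁅y⁆⇒x≡y e (In⇒∈ h)

In-⁅self⁆ : ∀ {n} (e : Fin n) → In ⁅ e ⁆ e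
In-⁅self⁆ e = ∈⇒In (SubsetP.x∈⁅x⁆ e)

⁅⁆≡∅[]≔ : ∀ {n} (p : Fin n) → ⁅ p ⁆ ≡ ∅ [ p ]≔ inside
⁅⁆≡∅[]≔ zero    = refl
⁅⁆≡∅[]≔ (suc p) = cong (outside ∷_) (⁅⁆≡∅[]≔ p)

lookup-[]≔ : ∀ {n} (X : Subset n) i b j → lookup (X [ i ]≔ b) j ≡ (if does (i Fin.≟ j) then b else lookup X j)
lookup-[]≔ X i b j with i Fin.≟ j
... | yes refl = VecP.lookup∘update i X b
... | no i≢j   = VecP.lookup∘update′ (λ eq → i≢j (sym eq)) X b

lookup-[]≔-same : ∀ {n} (X : Subset n) i b → lookup (X [ i ]≔ b) i ≡ b
lookup-[]≔-same X i b = VecP.lookup∘update i X b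

lookup-[]≔-other : ∀ {n} (X : Subset n) {i j} b → i ≢ j → lookup (X [ i ]≔ b) j ≡ lookup X j
lookup-[]≔-other X b i≢j = VecP.lookup∘update′ (λ eq → i≢j (sym eq)) X b

lookup-⁅⁆-other : ∀ {n} {e i : Fin n} → e ≢ i → Out ⁅ e ⁆ i
lookup-⁅⁆-other {e = e} {i} e≢i =
  trans (cong (λ W → lookup W i) (⁅⁆≡∅[]≔ e)) (trans (lookup-[]≔-other ∅ inside e≢i) (lookup-∅ i))

∪⁅⁆≡[]≔ : ∀ {n} (X : Subset n) e → X ∪ ⁅ e ⁆ ≡ X [ e ]≔ inside
∪⁅⁆≡[]≔ X e = lookup-ext _ _ pointwise
  where
  pointwise : ∀ i → lookup (X ∪ ⁅ e ⁆) i ≡ lookup (X [ e ]≔ inside) i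
  pointwise i rewrite VecP.lookup-zipWith _∨_ i X ⁅ e ⁆ | lookup-[]≔ X e inside i with e Fin.≟ i
  ... | yes refl rewrite In-⁅self⁆ e = BoolP.∨-zeroʳ (lookup X e)
  ... | no e≢i rewrite lookup-⁅⁆-other e≢i = BoolP.∨-identityʳ (lookup X i)

⊆-[]≔inside : ∀ {n} (X : Subset n) i → X ⊆ X [ i ]≔ inside
⊆-[]≔inside X i = mk⊆ pointwise
  where
  pointwise : ∀ j → In X j → In (X [ i ]≔ inside) j
  pointwise j p rewrite lookup-[]≔ X i inside j with i Fin.≟ j
  ... | yes _ = refl
  ... | no _  = p

[]≔outside-⊆ : ∀ {n} (X : Subset n) i → X [ i ]≔ outside ⊆ X
[]≔outside-⊆ X i = mk⊆ pointwise
  where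
  pointwise : ∀ j → In (X [ i ]≔ outside) j → In X j
  pointwise j p rewrite lookup-[]≔ X i outside j with i Fin.≟ j
  ... | yes _ = ⊥-elim (true≢false (sym p))
  ... | no _  = p

∣∣-[]≔inside : ∀ {n} (X : Subset n) i → Out X i → ∣ X [ i ]≔ inside ∣ ≡ suc ∣ X ∣
∣∣-[]≔inside (outside ∷ X) zero    refl = refl
∣∣-[]≔inside (inside ∷ X)  (suc i) p    = cong suc (∣∣-[]≔inside X i p)
∣∣-[]≔inside (outside ∷ X) (suc i) p    = ∣∣-[]≔inside X i p

∣∣-[]≔outside : ∀ {n} (X : Subset n) i → In X i → ∣ X ∣ ≡ suc ∣ X [ i ]≔ outside ∣
∣∣-[]≔outside (inside ∷ X) zero    refl = refl
∣∣-[]≔outside (inside ∷ X)  (suc i) p    = cong suc (∣∣-[]≔outside X i p)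
∣∣-[]≔outside (outside ∷ X) (suc i) p    = ∣∣-[]≔outside X i p

∣∣-insertAt : ∀ {n} (X : Subset n) i b → ∣ insertAt X i b ∣ ≡ (if b then suc ∣ X ∣ else ∣ X ∣)
∣∣-insertAt X             zero    inside  = refl
∣∣-insertAt X             zero    outside = refl
∣∣-insertAt (inside ∷ X)  (suc i) b rewrite ∣∣-insertAt X i b with b
... | inside  = refl
... | outside = refl
∣∣-insertAt (outside ∷ X) (suc i) b = ∣∣-insertAt X i b

Out⇒∣∣<n : ∀ {n} (X : Subset n) i → Out X i → ∣ X ∣ < n
Out⇒∣∣<n {n} X i p = subst (_≤ n) (∣∣-[]≔inside X i p) (SubsetP.∣p∣≤n (X [ i ]≔ inside))

In⇒∣∣>0 : ∀ {n} (X : Subset n) i → In X i → 0 < ∣ X ∣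
In⇒∣∣>0 X i p rewrite ∣∣-[]≔outside X i p = s≤s z≤n

∣∣>0⇒In : ∀ {n} (X : Subset n) → 0 < ∣ X ∣ → ∃ λ i → In X i
∣∣>0⇒In (inside ∷ X)  p = zero , refl
∣∣>0⇒In (outside ∷ X) p with ∣∣>0⇒In X p
... | i , q = suc i , q

∣∣≡0⇒Out : ∀ {n} (X : Subset n) → ∣ X ∣ ≡ 0 → ∀ i → Out X i
∣∣≡0⇒Out X c i = ¬In⇒Out {X = X} (λ p → ℕP.<-irrefl refl (subst (0 <_) c (In⇒∣∣>0 X i p)))

∣∣≡2⇒pair : ∀ {n} (C : Subset n) e → In C e → ∣ C ∣ ≡ 2 →
            ∃ λ s → e ≢ s × In C s × (∀ t → In C t → t ≡ e ⊎ t ≡ s)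
∣∣≡2⇒pair C e e∈C ∣C∣≡2 with ∣∣>0⇒In C₋ (subst (0 <_) (sym ∣C₋∣≡1) (s≤s z≤n))
  where
  C₋ = C [ e ]≔ outside
  ∣C₋∣≡1 : ∣ C₋ ∣ ≡ 1
  ∣C₋∣≡1 = ℕP.suc-injective (trans (sym (∣∣-[]≔outside C e e∈C)) ∣C∣≡2)
... | s , s∈C₋ = s , e≢s , s∈C , only
  where
  C₋ = C [ e ]≔ outside
  e≢s : e ≢ s
  e≢s refl = in-and-out s∈C₋ (lookup-[]≔-same C e outside)
  s∈C : In C s
  s∈C = trans (sym (lookup-[]≔-other C outside e≢s)) s∈C₋
  only : ∀ t → In C t → t ≡ e ⊎ t ≡ s
  only t t∈C with e Fin.≟ t | s Fin.≟ t
  ... | yes eq  | _       = inj₁ (sym eq)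
  ... | no _    | yes eq  = inj₂ (sym eq)
  ... | no e≢t  | no s≢t  = ⊥-elim (in-and-out t∈C₋₋ (∣∣≡0⇒Out (C₋ [ s ]≔ outside) ∣C₋₋∣≡0 t))
    where
    t∈C₋₋ : In (C₋ [ s ]≔ outside) t
    t∈C₋₋ = trans (lookup-[]≔-other C₋ outside s≢t) (trans (lookup-[]≔-other C outside e≢t) t∈C)
    ∣C₋₋∣≡0 : ∣ C₋ [ s ]≔ outside ∣ ≡ 0
    ∣C₋₋∣≡0 = ℕP.suc-injective (trans (sym (∣∣-[]≔outside C₋ s s∈C₋))
                (ℕP.suc-injective (trans (sym (∣∣-[]≔outside C e e∈C)) ∣C∣≡2)))

⁅⁆⊂ : ∀ {n} {C : Subset n} {e s} → e ≢ s → In C e → In C s → ⁅ s ⁆ ⊂ C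
⁅⁆⊂ {C = C} e≢s e∈C s∈C =
  mk⊆ (λ t t∈⁅s⁆ → subst (In C) (sym (In-⁅⁆ t∈⁅s⁆)) s∈C) , _ , In⇒∈ e∈C , λ e∈⁅s⁆ → e≢s (In-⁅⁆ (∈⇒In e∈⁅s⁆))

[]≔-mono : ∀ {n} {X Y : Subset n} {i} b → X ⊆ Y → X [ i ]≔ b ⊆ Y [ i ]≔ b
[]≔-mono {X = X} {Y} {i} b X⊆Y = mk⊆ pointwise
  where
  pointwise : ∀ j → In (X [ i ]≔ b) j → In (Y [ i ]≔ b) j
  pointwise j p rewrite lookup-[]≔ X i b j | lookup-[]≔ Y i b j with i Fin.≟ j
  ... | yes _ = p
  ... | no _  = use⊆ X⊆Y j p

[]≔inside-⊆ : ∀ {n} {X Y : Subset n} {i} → X ⊆ Y → In Y i → X [ i ]≔ inside ⊆ Y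
[]≔inside-⊆ {X = X} {Y} {i} X⊆Y i∈Y = mk⊆ pointwise
  where
  pointwise : ∀ j → In (X [ i ]≔ inside) j → In Y j
  pointwise j p rewrite lookup-[]≔ X i inside j with i Fin.≟ j
  ... | yes refl = i∈Y
  ... | no _     = use⊆ X⊆Y j p

⊆-[]≔outside : ∀ {n} {X Y : Subset n} {i} → X ⊆ Y → Out X i → X ⊆ Y [ i ]≔ outside
⊆-[]≔outside {X = X} {Y} {i} X⊆Y i∉X = mk⊆ pointwise
  where
  pointwise : ∀ j → In X j → In (Y [ i ]≔ outside) j
  pointwise j p rewrite lookup-[]≔ Y i outside j with i Fin.≟ j
  ... | yes refl = ⊥-elim (in-and-out p i∉X)
  ... | no _     = use⊆ X⊆Y j p

-- Bases, and exchange of parallel and of series elements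

record ParallelPair {n} (I : SetSystem n) (e p : Fin n) : Set where
  field
    distinct  : e ≢ p
    e-indep   : Indep I (∅ [ e ]≔ inside)
    p-indep   : Indep I (∅ [ p ]≔ inside)
    dependent : ∀ X → In X e → In X p → Dep I X

ParallelPair-sym : ∀ {n} {I : SetSystem n} {e p} → ParallelPair I e p → ParallelPair I p e
ParallelPair-sym pair = record
  { distinct  = λ eq → distinct (sym eq)
  ; e-indep   = p-indep
  ; p-indep   = e-indep
  ; dependent = λ X p∈X e∈X → dependent X e∈X p∈X
  }
  where open ParallelPair pair

record SeriesPair {n} (I : SetSystem n) (e s : Fin n) : Set where
  field
    distinct              : e ≢ s
    meets-bases           : ∀ B → IsBasis I B → In B e ⊎ In B s
    basis-avoiding-first  : ∃ λ B → IsBasis I B × Out B e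
    basis-avoiding-second : ∃ λ B → IsBasis I B × Out B s

SeriesPair-sym : ∀ {n} {I : SetSystem n} {e s} → SeriesPair I e s → SeriesPair I s e
SeriesPair-sym pair = record
  { distinct              = λ eq → distinct (sym eq)
  ; meets-bases           = λ B bB → Data.Sum.swap (meets-bases B bB)
  ; basis-avoiding-first  = basis-avoiding-second
  ; basis-avoiding-second = basis-avoiding-first
  }
  where open SeriesPair pair

twoCircuit⇒parallelPair : ∀ {n} {I : SetSystem n} {e} → IsMatroid I → InTwoCircuit I e →
                          ∃ λ p → ParallelPair I e p
twoCircuit⇒parallelPair {I = I} {e} isMatroid (C , (C-dep , C-minimal) , e∈C′ , ∣C∣≡2)
  with ∣∣≡2⇒pair C e (∈⇒In e∈C′) ∣C∣≡2
... | p , e≢p , p∈C , only = p , record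
  { distinct  = e≢p
  ; e-indep   = singleton-indep (⁅⁆⊂ (λ eq → e≢p (sym eq)) p∈C e∈C)
  ; p-indep   = singleton-indep (⁅⁆⊂ e≢p e∈C p∈C)
  ; dependent = dependent
  }
  where
  e∈C = ∈⇒In e∈C′
  singleton-indep : ∀ {x} → ⁅ x ⁆ ⊂ C → Indep I (∅ [ x ]≔ inside)
  singleton-indep {x} ⊂C = subst (Indep I) (⁅⁆≡∅[]≔ x) (C-minimal ⁅ x ⁆ ⊂C)
  dependent : ∀ X → In X e → In X p → Dep I X
  dependent X e∈X p∈X with I X in indep
  ... | false = refl
  ... | true  = ⊥-elim (in-and-out (IsMatroid.down-closed isMatroid C X (mk⊆ C⊆X) indep) C-dep)
    where
    C⊆X : ∀ t → In C t → In X t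
    C⊆X t t∈C with only t t∈C
    ... | inj₁ refl = e∈X
    ... | inj₂ refl = p∈X

twoCocircuit⇒seriesPair : ∀ {n} {I : SetSystem n} {e} → InTwoCocircuit I e → ∃ λ s → SeriesPair I e s
twoCocircuit⇒seriesPair {I = I} {e} (C , (C-not-coindep , C-minimal) , e∈C′ , ∣C∣≡2)
  with ∣∣≡2⇒pair C e (∈⇒In e∈C′) ∣C∣≡2
... | s , e≢s , s∈C , only = s , record
  { distinct              = e≢s
  ; meets-bases           = meets-bases
  ; basis-avoiding-first  = basis-avoiding (C-minimal ⁅ e ⁆ (⁅⁆⊂ (λ eq → e≢s (sym eq)) s∈C e∈C))
  ; basis-avoiding-second = basis-avoiding (C-minimal ⁅ s ⁆ (⁅⁆⊂ e≢s e∈C s∈C))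
  }
  where
  e∈C = ∈⇒In e∈C′
  basis-avoiding : ∀ {x} → CoIndep I ⁅ x ⁆ → ∃ λ B → IsBasis I B × Out B x
  basis-avoiding {x} (B , bB , ⁅x⁆⊆∁B) =
    B , bB , ¬In⇒Out {X = B} (λ x∈B → SubsetP.x∈∁p⇒x∉p (⁅x⁆⊆∁B (SubsetP.x∈⁅x⁆ x)) (In⇒∈ x∈B))
  meets-bases : ∀ B → IsBasis I B → In B e ⊎ In B s
  meets-bases B bB with lookup B e in e∈?B | lookup B s in s∈?B
  ... | true  | _     = inj₁ refl
  ... | false | true  = inj₂ refl
  ... | false | false = ⊥-elim (C-not-coindep (B , bB , mk⊆ C⊆∁B))
    where
    C⊆∁B : ∀ u → In C u → In (∁ B) u
    C⊆∁B u u∈C with only u u∈C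
    ... | inj₁ refl = ∈⇒In (SubsetP.x∉p⇒x∈∁p (Out⇒∉ {X = B} e∈?B))
    ... | inj₂ refl = ∈⇒In (SubsetP.x∉p⇒x∈∁p (Out⇒∉ {X = B} s∈?B))

module MatroidProperties {n} {I : SetSystem n} (isMatroid : IsMatroid I) where
  open IsMatroid isMatroid

  indep-⊆ : ∀ {X Y} → X ⊆ Y → Indep I Y → Indep I X
  indep-⊆ {X} {Y} = down-closed X Y

  augment : ∀ X Y → Indep I X → Indep I Y → ∣ X ∣ < ∣ Y ∣ →
            ∃ λ e → In Y e × Out X e × Indep I (X [ e ]≔ inside)
  augment X Y p q lt with exchange X Y p q lt
  ... | e , e∈Y , e∉X , r =
    e , ∈⇒In e∈Y , ¬In⇒Out {X = X} (λ z → e∉X (In⇒∈ z)) , subst (Indep I) (∪⁅⁆≡[]≔ X e) r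

  maximal⇒basis : ∀ B → Indep I B → (∀ y → Out B y → Dep I (B [ y ]≔ inside)) → IsBasis I B
  maximal⇒basis B p maximal = p , λ Y q B⊆Y → mk⊆ (λ i i∈Y → in-B Y q B⊆Y i i∈Y)
    where
    in-B : ∀ Y → Indep I Y → B ⊆ Y → ∀ i → In Y i → In B i
    in-B Y q B⊆Y i i∈Y with lookup B i in i∉B
    ... | true  = refl
    ... | false = ⊥-elim (in-and-out (indep-⊆ ([]≔inside-⊆ B⊆Y i∈Y) q) (maximal i i∉B))

  basis-maximal : ∀ B → IsBasis I B → ∀ w → Out B w → Indep I (B [ w ]≔ inside) → ⊥e
  basis-maximal B (_ , maximal) w w∉B q =
    in-and-out (use⊆ (maximal _ q (⊆-[]≔inside B w)) w (lookup-[]≔-same B w inside)) w∉B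

  ∣indep∣≤∣basis∣ : ∀ B A → IsBasis I B → Indep I A → ∣ A ∣ ≤ ∣ B ∣
  ∣indep∣≤∣basis∣ B A bB q = ℕP.≮⇒≥ larger
    where
    larger : ¬ ∣ B ∣ < ∣ A ∣
    larger lt with augment B A (proj₁ bB) q lt
    ... | w , _ , w∉B , r = basis-maximal B bB w w∉B r

  indep-of-basis-size⇒basis : ∀ B A → IsBasis I B → Indep I A → ∣ B ∣ ≤ ∣ A ∣ → IsBasis I A
  indep-of-basis-size⇒basis B A bB q le = maximal⇒basis A q maximal
    where
    maximal : ∀ y → Out A y → Dep I (A [ y ]≔ inside)
    maximal y y∉A with I (A [ y ]≔ inside) in indep
    ... | false = refl
    ... | true  = ⊥-elim (ℕP.<⇒≱ (subst (∣ B ∣ <_) (sym (∣∣-[]≔inside A y y∉A)) (s≤s le))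
                                   (∣indep∣≤∣basis∣ B _ bB indep))

  extend-to-basis : ∀ X → Indep I X → ∃ λ B → IsBasis I B × X ⊆ B
  extend-to-basis X p = extend n X (ℕP.m≤m+n n _) p
    where
    extend : ∀ k X → n ≤ k ℕ.+ ∣ X ∣ → Indep I X → ∃ λ B → IsBasis I B × X ⊆ B
    extend k X bound p
      with FinP.any? (λ y → (lookup X y Bool.≟ outside) ×-dec (I (X [ y ]≔ inside) Bool.≟ true))
    ... | no cannot-grow = X , maximal⇒basis X p maximal , SubsetP.⊆-refl
      where
      maximal : ∀ y → Out X y → Dep I (X [ y ]≔ inside)
      maximal y y∉X with I (X [ y ]≔ inside) in indep
      ... | false = refl
      ... | true  = ⊥-elim (cannot-grow (y , y∉X , indep))
    extend zero    X bound p | yes (y , y∉X , _) = ⊥-elim (ℕP.<⇒≱ (Out⇒∣∣<n X y y∉X) bound)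
    extend (suc k) X bound p | yes (y , y∉X , q) with extend k (X [ y ]≔ inside) bound′ q
      where
      bound′ : n ≤ k ℕ.+ ∣ X [ y ]≔ inside ∣
      bound′ rewrite ∣∣-[]≔inside X y y∉X | ℕP.+-suc k ∣ X ∣ = bound
    ... | B , bB , X⊆B = B , bB , λ z → X⊆B (⊆-[]≔inside X y z)

  -- Augmenting Z - z + p from the larger Z + e can only add z back, since adding e would
  -- create the dependent pair {e, p}.
  module Parallel {e p : Fin n} (pair : ParallelPair I e p) where
    open ParallelPair pair renaming (distinct to e≢p; dependent to e-p-dependent)

    replace-step : ∀ Z z → In Z z → Out Z e → Out Z p → Indep I (Z [ e ]≔ inside) →
                   Indep I (Z [ z ]≔ outside [ p ]≔ inside) → Indep I (Z [ p ]≔ inside)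
    replace-step Z z z∈Z e∉Z p∉Z q A-indep with augment A (Z [ e ]≔ inside) A-indep q ∣A∣<∣Z+e∣
      where
      A = Z [ z ]≔ outside [ p ]≔ inside
      z≢p : z ≢ p
      z≢p refl = in-and-out z∈Z p∉Z
      ∣A∣<∣Z+e∣ : ∣ A ∣ < ∣ Z [ e ]≔ inside ∣
      ∣A∣<∣Z+e∣ rewrite ∣∣-[]≔inside (Z [ z ]≔ outside) p (trans (lookup-[]≔-other Z outside z≢p) p∉Z)
                      | ∣∣-[]≔inside Z e e∉Z | sym (∣∣-[]≔outside Z z z∈Z) = ℕP.n<1+n ∣ Z ∣
    ... | y , y∈Z+e , y∉A , r with y Fin.≟ e
    ...   | yes refl = ⊥-elim (in-and-out r (e-p-dependent (A [ e ]≔ inside) (lookup-[]≔-same A e inside)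
                         (trans (lookup-[]≔-other A inside e≢p) (lookup-[]≔-same (Z [ z ]≔ outside) p inside))))
      where
      A = Z [ z ]≔ outside [ p ]≔ inside
    ...   | no y≢e = subst (Indep I) A+z≡Z+p (subst (λ y → Indep I (A [ y ]≔ inside)) y≡z r)
      where
      A = Z [ z ]≔ outside [ p ]≔ inside
      y∈Z : In Z y
      y∈Z = trans (sym (lookup-[]≔-other Z inside (λ eq → y≢e (sym eq)))) y∈Z+e
      y≡z : y ≡ z
      y≡z with y Fin.≟ p | y Fin.≟ z
      ... | yes refl | _     = ⊥-elim (in-and-out (lookup-[]≔-same (Z [ z ]≔ outside) y inside) y∉A)
      ... | no _     | yes eq = eq
      ... | no y≢p   | no y≢z = ⊥-elim (in-and-out y∈Z
              (trans (sym (lookup-[]≔-other Z outside (λ eq → y≢z (sym eq))))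
                     (trans (sym (lookup-[]≔-other (Z [ z ]≔ outside) inside (λ eq → y≢p (sym eq)))) y∉A)))
      A+z≡Z+p : A [ z ]≔ inside ≡ Z [ p ]≔ inside
      A+z≡Z+p = lookup-ext _ _ pointwise
        where
        pointwise : ∀ i → lookup (A [ z ]≔ inside) i ≡ lookup (Z [ p ]≔ inside) i
        pointwise i rewrite lookup-[]≔ A z inside i | lookup-[]≔ (Z [ z ]≔ outside) p inside i
                          | lookup-[]≔ Z z outside i | lookup-[]≔ Z p inside i
          with z Fin.≟ i | p Fin.≟ i
        ... | yes refl | yes _ = refl
        ... | yes refl | no _  = sym z∈Z
        ... | no _     | yes _ = refl
        ... | no _     | no _  = refl

    replace : ∀ k Z → ∣ Z ∣ ≡ k → Out Z e → Out Z p →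
              Indep I (Z [ e ]≔ inside) → Indep I (Z [ p ]≔ inside)
    replace zero Z ∣Z∣≡0 e∉Z p∉Z q = subst (λ W → Indep I (W [ p ]≔ inside)) (sym Z≡∅) p-indep
      where
      Z≡∅ : Z ≡ ∅
      Z≡∅ = lookup-ext Z ∅ λ i → trans (∣∣≡0⇒Out Z ∣Z∣≡0 i) (sym (lookup-∅ i))
    replace (suc k) Z ∣Z∣≡1+k e∉Z p∉Z q with ∣∣>0⇒In Z (subst (0 <_) (sym ∣Z∣≡1+k) (s≤s z≤n))
    ... | z , z∈Z = replace-step Z z z∈Z e∉Z p∉Z q
                      (replace k (Z [ z ]≔ outside) ∣Z₀∣≡k (outside-of e∉Z) (outside-of p∉Z)
                        (indep-⊆ ([]≔-mono inside ([]≔outside-⊆ Z z)) q))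
      where
      ∣Z₀∣≡k : ∣ Z [ z ]≔ outside ∣ ≡ k
      ∣Z₀∣≡k = ℕP.suc-injective (trans (sym (∣∣-[]≔outside Z z z∈Z)) ∣Z∣≡1+k)
      outside-of : ∀ {x} → Out Z x → Out (Z [ z ]≔ outside) x
      outside-of {x} x∉Z with z Fin.≟ x
      ... | yes refl = ⊥-elim (in-and-out z∈Z x∉Z)
      ... | no z≢x   = trans (lookup-[]≔-other Z outside z≢x) x∉Z

  parallel-replace : ∀ {e p} → ParallelPair I e p →
                     ∀ X → In X e → Out X p → I X ≡ I (X [ e ]≔ outside [ p ]≔ inside)
  parallel-replace {e} {p} pair X e∈X p∉X =
    Bool-ext (λ q → Parallel.replace pair _ Z refl e∉Z p∉Z (subst (Indep I) X≡Z+e q))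
             (λ q → subst (Indep I) (sym X≡Z+e)
                (Parallel.replace (ParallelPair-sym pair) _ Z refl p∉Z e∉Z q))
    where
    Z = X [ e ]≔ outside
    e∉Z : Out Z e
    e∉Z = lookup-[]≔-same X e outside
    p∉Z : Out Z p
    p∉Z = trans (lookup-[]≔-other X outside (ParallelPair.distinct pair)) p∉X
    X≡Z+e : X ≡ Z [ e ]≔ inside
    X≡Z+e = lookup-ext _ _ pointwise
      where
      pointwise : ∀ i → lookup X i ≡ lookup (Z [ e ]≔ inside) i
      pointwise i rewrite lookup-[]≔ Z e inside i | lookup-[]≔ X e outside i with e Fin.≟ i
      ... | yes refl = e∈X
      ... | no _     = refl

  -- Augmenting B - s from a basis B₁ avoiding s gives a basis, which meets {e, s} but
  -- cannot contain s, so the element added must be e.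
  module Series {e s : Fin n} (pair : SeriesPair I e s) where
    open SeriesPair pair renaming (distinct to e≢s; meets-bases to meets)

    private
      B₁ = proj₁ basis-avoiding-second
      b₁ = proj₁ (proj₂ basis-avoiding-second)
      s∉B₁ = proj₂ (proj₂ basis-avoiding-second)

    basis-replace : ∀ B → IsBasis I B → In B s → Out B e → Indep I (B [ s ]≔ outside [ e ]≔ inside)
    basis-replace B bB s∈B e∉B with augment A B₁ A-indep (proj₁ b₁) ∣A∣<∣B₁∣
      where
      A = B [ s ]≔ outside
      A-indep : Indep I A
      A-indep = indep-⊆ ([]≔outside-⊆ B s) (proj₁ bB)
      ∣A∣<∣B₁∣ : ∣ A ∣ < ∣ B₁ ∣
      ∣A∣<∣B₁∣ = subst (_≤ ∣ B₁ ∣) (∣∣-[]≔outside B s s∈B) (∣indep∣≤∣basis∣ B₁ B b₁ (proj₁ bB))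
    ... | y , y∈B₁ , y∉A , r with y Fin.≟ e
    ...   | yes refl = r
    ...   | no y≢e with meets (A [ y ]≔ inside) (indep-of-basis-size⇒basis B (A [ y ]≔ inside) bB r ∣B∣≤∣A+y∣)
      where
      A = B [ s ]≔ outside
      ∣B∣≤∣A+y∣ : ∣ B ∣ ≤ ∣ A [ y ]≔ inside ∣
      ∣B∣≤∣A+y∣ rewrite ∣∣-[]≔inside A y y∉A = ℕP.≤-reflexive (∣∣-[]≔outside B s s∈B)
    ...     | inj₁ e∈A+y = ⊥-elim (in-and-out e∈A+y
                (trans (lookup-[]≔-other (B [ s ]≔ outside) inside y≢e)
                  (trans (lookup-[]≔-other B outside (λ eq → e≢s (sym eq))) e∉B)))
    ...     | inj₂ s∈A+y with y Fin.≟ s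
    ...       | yes refl = ⊥-elim (in-and-out y∈B₁ s∉B₁)
    ...       | no y≢s   = ⊥-elim (in-and-out s∈A+y
                  (trans (lookup-[]≔-other (B [ s ]≔ outside) inside y≢s) (lookup-[]≔-same B s outside)))

    add : ∀ X → Out X e → Out X s → Indep I X → Indep I (X [ e ]≔ inside)
    add X e∉X s∉X q with extend-to-basis X q
    ... | B , bB , X⊆B with lookup B e in e∈?B
    ...   | true  = indep-⊆ ([]≔inside-⊆ X⊆B e∈?B) (proj₁ bB)
    ...   | false with meets B bB
    ...     | inj₁ e∈B = ⊥-elim (in-and-out e∈B e∈?B)
    ...     | inj₂ s∈B = indep-⊆ ([]≔-mono inside (⊆-[]≔outside X⊆B s∉X)) (basis-replace B bB s∈B e∈?B)

    replace : ∀ X → Out X e → In X s → Indep I X → Indep I (X [ s ]≔ outside [ e ]≔ inside)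
    replace X e∉X s∈X q with extend-to-basis X q
    ... | B , bB , X⊆B with lookup B e in e∈?B
    ...   | true  = indep-⊆ ([]≔inside-⊆ (SubsetP.⊆-trans ([]≔outside-⊆ X s) X⊆B) e∈?B) (proj₁ bB)
    ...   | false = indep-⊆ ([]≔-mono inside ([]≔-mono outside X⊆B)) (basis-replace B bB (use⊆ X⊆B s s∈X) e∈?B)

-- Isomorphisms

lookup-image : ∀ {m n} (σ : Permutation m n) (X : Subset m) j → lookup (image σ X) j ≡ lookup X (σ ⟨$⟩ˡ j)
lookup-image σ X j = VecP.lookup∘tabulate _ j

insertAt-unique : ∀ {n} (W : Subset n) (Z : Subset (suc n)) i v → lookup Z i ≡ v →
                  (∀ k → lookup Z (punchIn i k) ≡ lookup W k) → insertAt W i v ≡ Z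
insertAt-unique W Z i v at-i elsewhere = lookup-ext _ _ pointwise
  where
  pointwise : ∀ j → lookup (insertAt W i v) j ≡ lookup Z j
  pointwise j with i Fin.≟ j
  ... | yes refl = trans (VecP.insertAt-lookup W i v) (sym at-i)
  ... | no i≢j   = subst (λ j′ → lookup (insertAt W i v) j′ ≡ lookup Z j′) (FinP.punchIn-punchOut i≢j)
                     (trans (VecP.insertAt-punchIn W i v (punchOut i≢j)) (sym (elsewhere (punchOut i≢j))))

≗⇒≅ : ∀ {n} {S T : SetSystem n} → (∀ X → S X ≡ T X) → S ≅ T
≗⇒≅ {T = T} S≗T = Perm.id , λ X → trans (S≗T X) (cong T (sym (lookup-ext _ _ (lookup-image Perm.id X))))

≅-refl : ∀ {n} {S : SetSystem n} → S ≅ S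
≅-refl = ≗⇒≅ (λ _ → refl)

≅-sym : ∀ {m n} {S : SetSystem m} {T : SetSystem n} → S ≅ T → T ≅ S
≅-sym {S = S} {T} (σ , h) = flip σ , λ Y → trans (cong T (sym (image-flip Y))) (sym (h (image (flip σ) Y)))
  where
  image-flip : ∀ Y → image σ (image (flip σ) Y) ≡ Y
  image-flip Y = lookup-ext _ _ λ j →
    trans (lookup-image σ (image (flip σ) Y) j) (trans (lookup-image (flip σ) Y _) (cong (lookup Y) (inverseʳ σ)))

≅-trans : ∀ {l m n} {R : SetSystem l} {S : SetSystem m} {T : SetSystem n} → R ≅ S → S ≅ T → R ≅ T
≅-trans {T = T} (σ , h) (τ , k) = σ Perm.∘ₚ τ , λ X → trans (h X) (trans (k _) (cong T (image-∘ X)))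
  where
  image-∘ : ∀ X → image τ (image σ X) ≡ image (σ Perm.∘ₚ τ) X
  image-∘ X = lookup-ext _ _ λ j →
    trans (lookup-image τ (image σ X) j) (trans (lookup-image σ X _) (sym (lookup-image (σ Perm.∘ₚ τ) X j)))

toFront : ∀ {n} → Fin (suc n) → SetSystem (suc n) → SetSystem (suc n)
toFront i S (x ∷ X) = S (insertAt X i x)

toFront-permutation : ∀ {n} → Fin (suc n) → Permutation (suc n) (suc n)
toFront-permutation {n} i = permutation to from from-to to-from
  where
  to : Fin (suc n) → Fin (suc n)
  to k with i Fin.≟ k
  ... | yes _  = zero
  ... | no i≢k = suc (punchOut i≢k)
  from : Fin (suc n) → Fin (suc n)
  from zero    = i
  from (suc k) = punchIn i k
  from-to : ∀ y → to (from y) ≡ y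
  from-to zero with i Fin.≟ i
  ... | yes _  = refl
  ... | no i≢i = ⊥-elim (i≢i refl)
  from-to (suc k) with i Fin.≟ punchIn i k
  ... | yes eq = ⊥-elim (FinP.punchInᵢ≢i i k (sym eq))
  ... | no _   = cong suc (trans (FinP.punchOut-cong i refl) (FinP.punchOut-punchIn i))
  to-from : ∀ x → from (to x) ≡ x
  to-from x with i Fin.≟ x
  ... | yes refl = refl
  ... | no i≢x   = FinP.punchIn-punchOut i≢x

≅-toFront : ∀ {n} (i : Fin (suc n)) (S : SetSystem (suc n)) → S ≅ toFront i S
≅-toFront i S = toFront-permutation i , λ Y →
  cong S (sym (insertAt-unique _ Y i _ refl (λ k → sym (VecP.lookup∘tabulate _ k))))

toFront-≅ : ∀ {n} (i : Fin (suc n)) (S : SetSystem (suc n)) → toFront i S ≅ S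
toFront-≅ i S = ≅-sym (≅-toFront i S)

≗toFront⇒≅ : ∀ {n} {S : SetSystem (suc n)} i (T : SetSystem (suc n)) → (∀ Z → S Z ≡ toFront i T Z) → S ≅ T
≗toFront⇒≅ i T pointwise = ≅-trans {S = toFront i T} {T = T} (≗⇒≅ pointwise) (toFront-≅ i T)

restrict : ∀ {m n} → Permutation (suc m) (suc n) → Fin (suc m) → Permutation m n
restrict σ f = flip (remove (σ ⟨$⟩ʳ f) (flip σ))

image-insertAt : ∀ {m n} (σ : Permutation (suc m) (suc n)) (X : Subset m) f b →
                 image σ (insertAt X f b) ≡ insertAt (image (restrict σ f) X) (σ ⟨$⟩ʳ f) b
image-insertAt σ X f b = sym (insertAt-unique _ _ (σ ⟨$⟩ʳ f) b at-σf elsewhere)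
  where
  at-σf : lookup (image σ (insertAt X f b)) (σ ⟨$⟩ʳ f) ≡ b
  at-σf = trans (lookup-image σ (insertAt X f b) _) (trans (cong (lookup (insertAt X f b)) (inverseˡ σ)) (VecP.insertAt-lookup X f b))
  elsewhere : ∀ k → lookup (image σ (insertAt X f b)) (punchIn (σ ⟨$⟩ʳ f) k) ≡ lookup (image (restrict σ f) X) k
  elsewhere k = trans (lookup-image σ (insertAt X f b) _)
                  (trans (cong (lookup (insertAt X f b)) (Perm.punchIn-permute′ (flip σ) f k))
                    (trans (VecP.insertAt-punchIn X f b _) (sym (lookup-image (restrict σ f) X k))))

image-∅ : ∀ {m n} (σ : Permutation m n) → image σ ∅ ≡ ∅
image-∅ σ = lookup-ext _ _ λ j → trans (lookup-image σ ∅ j) (trans (lookup-∅ (σ ⟨$⟩ˡ j)) (sym (lookup-∅ j)))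

⁅⁆≡insertAt∅ : ∀ {n} (f : Fin (suc n)) → ⁅ f ⁆ ≡ insertAt ∅ f inside
⁅⁆≡insertAt∅ {n}     zero    = refl
⁅⁆≡insertAt∅ {suc n} (suc f) = cong (outside ∷_) (⁅⁆≡insertAt∅ f)

image-⁅⁆ : ∀ {m n} (σ : Permutation (suc m) (suc n)) f → image σ ⁅ f ⁆ ≡ ⁅ σ ⟨$⟩ʳ f ⁆
image-⁅⁆ σ f rewrite ⁅⁆≡insertAt∅ f | ⁅⁆≡insertAt∅ (σ ⟨$⟩ʳ f) | image-insertAt σ ∅ f inside
                   | image-∅ (restrict σ f) = refl

∣image∣ : ∀ {m n} (σ : Permutation m n) (X : Subset m) → ∣ image σ X ∣ ≡ ∣ X ∣
∣image∣ {zero}  {zero}  σ []      = refl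
∣image∣ {zero}  {suc n} σ [] with σ ⟨$⟩ˡ zero
... | ()
∣image∣ {suc m} {zero}  σ X  with σ ⟨$⟩ʳ zero
... | ()
∣image∣ {suc m} {suc n} σ (x ∷ X) =
  trans (cong ∣_∣ (image-insertAt σ X zero x))
        (trans (∣∣-insertAt (image (restrict σ zero) X) (σ ⟨$⟩ʳ zero) x) (by-side x))
  where
  by-side : ∀ x → (if x then suc ∣ image (restrict σ zero) X ∣ else ∣ image (restrict σ zero) X ∣) ≡ ∣ x ∷ X ∣
  by-side true  = cong suc (∣image∣ (restrict σ zero) X)
  by-side false = ∣image∣ (restrict σ zero) X

∖-resp-≅ : ∀ {m n} {S : SetSystem (suc m)} {T : SetSystem (suc n)} → S ≅ T → ∀ f → ∃ λ g → (S ∖ f) ≅ (T ∖ g)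
∖-resp-≅ {T = T} (σ , h) f = σ ⟨$⟩ʳ f , restrict σ f , λ X → trans (h _) (cong T (image-insertAt σ X f outside))

／-resp-≅ : ∀ {m n} {S : SetSystem (suc m)} {T : SetSystem (suc n)} → S ≅ T → ∀ f → ∃ λ g → (S ／ f) ≅ (T ／ g)
／-resp-≅ {S = S} {T} (σ , h) f = σ ⟨$⟩ʳ f , restrict σ f , contracted
  where
  same-loop : S ⁅ f ⁆ ≡ T ⁅ σ ⟨$⟩ʳ f ⁆
  same-loop = trans (h _) (cong T (image-⁅⁆ σ f))
  contracted : ∀ X → (S ／ f) X ≡ (T ／ (σ ⟨$⟩ʳ f)) (image (restrict σ f) X)
  contracted X with S ⁅ f ⁆ | T ⁅ σ ⟨$⟩ʳ f ⁆ | same-loop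
  ... | true  | true  | refl = trans (h _) (cong T (image-insertAt σ X f inside))
  ... | false | false | refl = trans (h _) (cong T (image-insertAt σ X f outside))

⊕loop-resp-≅ : ∀ {m n} {S : SetSystem m} {T : SetSystem n} → S ≅ T → ⊕loop S ≅ ⊕loop T
⊕loop-resp-≅ (σ , h) = lift₀ σ , λ { (true ∷ X) → refl ; (false ∷ X) → h X }

⊕coloop-resp-≅ : ∀ {m n} {S : SetSystem m} {T : SetSystem n} → S ≅ T → ⊕coloop S ≅ ⊕coloop T
⊕coloop-resp-≅ (σ , h) = lift₀ σ , λ { (x ∷ X) → h X }

≅-isMatroid : ∀ {m n} {S : SetSystem m} {T : SetSystem n} → S ≅ T → IsMatroid T → IsMatroid S
≅-isMatroid {S = S} {T} (σ , h) isMatroid = record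
  { empty-indep = trans (h ∅) (trans (cong T (image-∅ σ)) empty-indep)
  ; down-closed = λ X Y X⊆Y q → trans (h X) (down-closed _ _ (image-mono X⊆Y) (trans (sym (h Y)) q))
  ; exchange    = exchange′
  }
  where
  open IsMatroid isMatroid
  image-mono : ∀ {X Y} → X ⊆ Y → image σ X ⊆ image σ Y
  image-mono {X} {Y} X⊆Y = mk⊆ λ j p →
    trans (lookup-image σ Y j) (use⊆ X⊆Y _ (trans (sym (lookup-image σ X j)) p))
  ⟨$⟩ˡ-injective : ∀ {i j} → σ ⟨$⟩ˡ i ≡ σ ⟨$⟩ˡ j → i ≡ j
  ⟨$⟩ˡ-injective eq = trans (sym (inverseʳ σ)) (trans (cong (σ ⟨$⟩ʳ_) eq) (inverseʳ σ))
  image-∪⁅⁆ : ∀ X e′ → image σ (X ∪ ⁅ σ ⟨$⟩ˡ e′ ⁆) ≡ image σ X ∪ ⁅ e′ ⁆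
  image-∪⁅⁆ X e′ rewrite ∪⁅⁆≡[]≔ X (σ ⟨$⟩ˡ e′) | ∪⁅⁆≡[]≔ (image σ X) e′ = lookup-ext _ _ pointwise
    where
    pointwise : ∀ j → lookup (image σ (X [ σ ⟨$⟩ˡ e′ ]≔ inside)) j ≡ lookup (image σ X [ e′ ]≔ inside) j
    pointwise j rewrite lookup-image σ (X [ σ ⟨$⟩ˡ e′ ]≔ inside) j with e′ Fin.≟ j
    ... | yes refl = trans (lookup-[]≔-same X _ inside) (sym (lookup-[]≔-same (image σ X) j inside))
    ... | no e′≢j  = trans (lookup-[]≔-other X inside (λ eq → e′≢j (⟨$⟩ˡ-injective eq)))
                       (trans (sym (lookup-image σ X j)) (sym (lookup-[]≔-other (image σ X) inside e′≢j)))
  exchange′ : ∀ X Y → Indep S X → Indep S Y → ∣ X ∣ < ∣ Y ∣ → ∃ λ e → e ∈ Y × e ∉ X × Indep S (X ∪ ⁅ e ⁆)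
  exchange′ X Y p q lt
    with exchange (image σ X) (image σ Y) (trans (sym (h X)) p) (trans (sym (h Y)) q)
                  (subst₂ _<_ (sym (∣image∣ σ X)) (sym (∣image∣ σ Y)) lt)
  ... | e′ , e′∈Y , e′∉X , r =
    σ ⟨$⟩ˡ e′ , In⇒∈ (trans (sym (lookup-image σ Y e′)) (∈⇒In e′∈Y)) ,
    (λ z → e′∉X (In⇒∈ (trans (lookup-image σ X e′) (∈⇒In z)))) ,
    trans (h _) (trans (cong T (image-∪⁅⁆ X e′)) r)

-- Parallel and series extensions in normal position

-- Element 0 is a copy of element 1 (element 0 of K), and the two together are dependent.
parallelExt : ∀ {n} → SetSystem (suc n) → SetSystem (suc (suc n))
parallelExt K (true  ∷ true  ∷ X) = false
parallelExt K (true  ∷ false ∷ X) = K (true ∷ X)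
parallelExt K (false ∷ b     ∷ X) = K (b ∷ X)

-- A set is independent iff it is independent in K after discarding one element of the
-- series pair {0, 1}: the new element 0 if present, otherwise its partner 1.
seriesProjection : ∀ {n} → Subset (suc (suc n)) → Subset (suc n)
seriesProjection (true  ∷ b ∷ X) = b ∷ X
seriesProjection (false ∷ b ∷ X) = false ∷ X

seriesExt : ∀ {n} → SetSystem (suc n) → SetSystem (suc (suc n))
seriesExt K Z = K (seriesProjection Z)

NonLoop₀ : ∀ {n} → SetSystem (suc n) → Set
NonLoop₀ K = Indep K (inside ∷ ∅)

NonColoop₀ : ∀ {n} → SetSystem (suc n) → Set
NonColoop₀ K = ∃ λ X → Indep K (outside ∷ X) × Dep K (inside ∷ X)

augment-witness : ∀ {n} (S : SetSystem n) X Y e → In Y e → Out X e → Indep S (X [ e ]≔ inside) →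
                  e ∈ Y × e ∉ X × Indep S (X ∪ ⁅ e ⁆)
augment-witness S X Y e e∈Y e∉X r = In⇒∈ e∈Y , Out⇒∉ {X = X} e∉X , subst (Indep S) (sym (∪⁅⁆≡[]≔ X e)) r

suc<∣∷∣⇒< : ∀ {n} x d (Y : Subset n) → suc x < ∣ d ∷ Y ∣ → x < ∣ Y ∣
suc<∣∷∣⇒< x true  Y (s≤s lt) = lt
suc<∣∷∣⇒< x false Y lt       = ℕP.<-trans (ℕP.n<1+n x) lt

seriesProjection-mono : ∀ {n} (X Y : Subset (suc (suc n))) → X ⊆ Y → seriesProjection X ⊆ seriesProjection Y
seriesProjection-mono (true  ∷ b ∷ X) (true  ∷ d ∷ Y) X⊆Y = SubsetP.drop-∷-⊆ X⊆Y
seriesProjection-mono (true  ∷ b ∷ X) (false ∷ d ∷ Y) X⊆Y with use⊆ X⊆Y zero refl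
... | ()
seriesProjection-mono (false ∷ b ∷ X) (true  ∷ d ∷ Y) X⊆Y = SubsetP.out⊆ (SubsetP.drop-∷-⊆ (SubsetP.drop-∷-⊆ X⊆Y))
seriesProjection-mono (false ∷ b ∷ X) (false ∷ d ∷ Y) X⊆Y = SubsetP.out⊆ (SubsetP.drop-∷-⊆ (SubsetP.drop-∷-⊆ X⊆Y))

seriesExt-isMatroid : ∀ {n} {K : SetSystem (suc n)} → IsMatroid K → IsMatroid (seriesExt K)
seriesExt-isMatroid {K = K} isMatroid = record
  { empty-indep = IsMatroid.empty-indep isMatroid
  ; down-closed = λ X Y X⊆Y → indep-⊆ (seriesProjection-mono X Y X⊆Y)
  ; exchange    = exchange′
  }
  where
  open MatroidProperties isMatroid
  exchange′ : ∀ X Y → Indep (seriesExt K) X → Indep (seriesExt K) Y → ∣ X ∣ < ∣ Y ∣ →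
              ∃ λ e → e ∈ Y × e ∉ X × Indep (seriesExt K) (X ∪ ⁅ e ⁆)
  exchange′ (false ∷ false ∷ X) (true ∷ d ∷ Y) p q lt =
    zero , augment-witness (seriesExt K) _ _ zero refl refl p
  exchange′ (false ∷ false ∷ X) (false ∷ true ∷ Y) p q lt =
    suc zero , augment-witness (seriesExt K) _ _ (suc zero) refl refl p
  exchange′ (false ∷ false ∷ X) (false ∷ false ∷ Y) p q lt with augment (false ∷ X) (false ∷ Y) p q lt
  ... | zero  , () , _
  ... | suc k , y∈Y , y∉X , r = suc (suc k) , augment-witness (seriesExt K) _ _ (suc (suc k)) y∈Y y∉X r
  exchange′ (false ∷ true ∷ X) (true ∷ d ∷ Y) p q lt with augment (false ∷ X) (d ∷ Y) p q (ℕP.≤-pred lt)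
  ... | zero  , _   , _   , r = zero , augment-witness (seriesExt K) _ _ zero refl refl r
  ... | suc k , y∈Y , y∉X , r = suc (suc k) , augment-witness (seriesExt K) _ _ (suc (suc k)) y∈Y y∉X r
  exchange′ (false ∷ true ∷ X) (false ∷ d ∷ Y) p q lt with augment (false ∷ X) (false ∷ Y) p q (suc<∣∷∣⇒< _ d Y lt)
  ... | zero  , () , _
  ... | suc k , y∈Y , y∉X , r = suc (suc k) , augment-witness (seriesExt K) _ _ (suc (suc k)) y∈Y y∉X r
  exchange′ (true ∷ b ∷ X) (true ∷ d ∷ Y) p q lt with augment (b ∷ X) (d ∷ Y) p q (ℕP.≤-pred lt)
  ... | zero  , y∈Y , y∉X , r = suc zero , augment-witness (seriesExt K) _ _ (suc zero) y∈Y y∉X r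
  ... | suc k , y∈Y , y∉X , r = suc (suc k) , augment-witness (seriesExt K) _ _ (suc (suc k)) y∈Y y∉X r
  exchange′ (true ∷ b ∷ X) (false ∷ d ∷ Y) p q lt with augment (b ∷ X) (false ∷ Y) p q (suc<∣∷∣⇒< _ d Y lt)
  ... | zero  , () , _
  ... | suc k , y∈Y , y∉X , r = suc (suc k) , augment-witness (seriesExt K) _ _ (suc (suc k)) y∈Y y∉X r

parallelProjection : ∀ {n} → Subset (suc (suc n)) → Subset (suc n)
parallelProjection (a ∷ b ∷ X) = (a ∨ b) ∷ X

∨-mono : ∀ a b c d → (a ≡ true → c ≡ true) → (b ≡ true → d ≡ true) → a ∨ b ≡ true → c ∨ d ≡ true
∨-mono true  b    c d a⇒c b⇒d _ rewrite a⇒c refl = refl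
∨-mono false true c d a⇒c b⇒d _ rewrite b⇒d refl = BoolP.∨-zeroʳ c

parallelProjection-mono : ∀ {n} (X Y : Subset (suc (suc n))) → X ⊆ Y → parallelProjection X ⊆ parallelProjection Y
parallelProjection-mono (a ∷ b ∷ X) (c ∷ d ∷ Y) X⊆Y = mk⊆ pointwise
  where
  pointwise : ∀ i → In (parallelProjection (a ∷ b ∷ X)) i → In (parallelProjection (c ∷ d ∷ Y)) i
  pointwise zero    = ∨-mono a b c d (use⊆ X⊆Y zero) (use⊆ X⊆Y (suc zero))
  pointwise (suc k) = use⊆ X⊆Y (suc (suc k))

parallelExt-indep : ∀ {n} (K : SetSystem (suc n)) Z → Indep (parallelExt K) Z → Indep K (parallelProjection Z)
parallelExt-indep K (true  ∷ false ∷ X) q = q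
parallelExt-indep K (false ∷ b     ∷ X) q = q

parallelExt-isMatroid : ∀ {n} {K : SetSystem (suc n)} → IsMatroid K → IsMatroid (parallelExt K)
parallelExt-isMatroid {K = K} isMatroid = record
  { empty-indep = IsMatroid.empty-indep isMatroid
  ; down-closed = down-closed′
  ; exchange    = exchange′
  }
  where
  open MatroidProperties isMatroid
  down-closed′ : ∀ X Y → X ⊆ Y → Indep (parallelExt K) Y → Indep (parallelExt K) X
  down-closed′ (true ∷ true ∷ X) (c ∷ d ∷ Y) X⊆Y q with use⊆ X⊆Y zero refl | use⊆ X⊆Y (suc zero) refl
  ... | refl | refl = q
  down-closed′ (true  ∷ false ∷ X) Y X⊆Y q = indep-⊆ (parallelProjection-mono _ Y X⊆Y) (parallelExt-indep K Y q)
  down-closed′ (false ∷ b     ∷ X) Y X⊆Y q = indep-⊆ (parallelProjection-mono _ Y X⊆Y) (parallelExt-indep K Y q)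
  exchange′ : ∀ X Y → Indep (parallelExt K) X → Indep (parallelExt K) Y → ∣ X ∣ < ∣ Y ∣ →
              ∃ λ e → e ∈ Y × e ∉ X × Indep (parallelExt K) (X ∪ ⁅ e ⁆)
  exchange′ (true ∷ true ∷ X) Y () q lt
  exchange′ X (true ∷ true ∷ Y) p () lt
  exchange′ (true ∷ false ∷ X) (true ∷ false ∷ Y) p q lt with augment (true ∷ X) (true ∷ Y) p q lt
  ... | zero  , _ , () , _
  ... | suc k , y∈Y , y∉X , r = suc (suc k) , augment-witness (parallelExt K) _ _ (suc (suc k)) y∈Y y∉X r
  exchange′ (true ∷ false ∷ X) (false ∷ d ∷ Y) p q lt with augment (true ∷ X) (d ∷ Y) p q lt
  ... | zero  , _ , () , _
  ... | suc k , y∈Y , y∉X , r = suc (suc k) , augment-witness (parallelExt K) _ _ (suc (suc k)) y∈Y y∉X r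
  exchange′ (false ∷ false ∷ X) (true ∷ false ∷ Y) p q lt with augment (false ∷ X) (true ∷ Y) p q lt
  ... | zero  , _   , _   , r = zero , augment-witness (parallelExt K) _ _ zero refl refl r
  ... | suc k , y∈Y , y∉X , r = suc (suc k) , augment-witness (parallelExt K) _ _ (suc (suc k)) y∈Y y∉X r
  exchange′ (false ∷ true ∷ X) (true ∷ false ∷ Y) p q lt with augment (true ∷ X) (true ∷ Y) p q lt
  ... | zero  , _ , () , _
  ... | suc k , y∈Y , y∉X , r = suc (suc k) , augment-witness (parallelExt K) _ _ (suc (suc k)) y∈Y y∉X r
  exchange′ (false ∷ b ∷ X) (false ∷ d ∷ Y) p q lt with augment (b ∷ X) (d ∷ Y) p q lt
  ... | zero  , y∈Y , y∉X , r = suc zero , augment-witness (parallelExt K) _ _ (suc zero) y∈Y y∉X r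
  ... | suc k , y∈Y , y∉X , r = suc (suc k) , augment-witness (parallelExt K) _ _ (suc (suc k)) y∈Y y∉X r

pair₀₁ : ∀ {n} → Subset (suc (suc n))
pair₀₁ = inside ∷ inside ∷ ∅

∣pair₀₁∣ : ∀ {n} → ∣ pair₀₁ {n} ∣ ≡ 2
∣pair₀₁∣ {n} = cong (λ k → suc (suc k)) (SubsetP.∣⊥∣≡0 n)

⊂pair₀₁-elim : ∀ {n} (P : Subset (suc (suc n)) → Set) →
               P (inside ∷ outside ∷ ∅) → P (outside ∷ inside ∷ ∅) → P ∅ → ∀ Y → Y ⊂ pair₀₁ → P Y
⊂pair₀₁-elim P P₀ P₁ P∅ (a ∷ b ∷ R) (Y⊆ , x , x∈pair , x∉Y)
  rewrite SubsetP.⊆-antisym (SubsetP.drop-∷-⊆ (SubsetP.drop-∷-⊆ Y⊆)) (SubsetP.⊆-min R) = by-cases a b x∉Y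
  where
  by-cases : ∀ a b → x ∉ a ∷ b ∷ ∅ → P (a ∷ b ∷ ∅)
  by-cases true  true  x∉Y = ⊥-elim (x∉Y x∈pair)
  by-cases true  false _   = P₀
  by-cases false true  _   = P₁
  by-cases false false _   = P∅

parallelExt-twoCircuit : ∀ {n} {K : SetSystem (suc n)} → IsMatroid K → NonLoop₀ K →
                         InTwoCircuit (parallelExt K) zero
parallelExt-twoCircuit {n} isMatroid nonLoop =
  pair₀₁ , (refl , ⊂pair₀₁-elim _ nonLoop nonLoop (IsMatroid.empty-indep isMatroid)) , In⇒∈ refl , ∣pair₀₁∣ {n}

parallelExt-∖₀ : ∀ {n} (K : SetSystem (suc n)) → (parallelExt K ∖ zero) ≅ K
parallelExt-∖₀ K = ≗⇒≅ {T = K} λ { (b ∷ X) → refl }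

nonColoop₀⇒basis : ∀ {n} {K : SetSystem (suc n)} → IsMatroid K → NonColoop₀ K → ∃ λ B → IsBasis K (outside ∷ B)
nonColoop₀⇒basis {K = K} isMatroid (X , X-indep , X+0-dep) with extend-to-basis (outside ∷ X) X-indep
  where open MatroidProperties isMatroid
... | inside  ∷ B , bB , X⊆B =
  ⊥-elim (in-and-out (indep-⊆ (SubsetP.s⊆s (SubsetP.drop-∷-⊆ X⊆B)) (proj₁ bB)) X+0-dep)
  where open MatroidProperties isMatroid
... | outside ∷ B , bB , _ = B , bB

module SeriesExtBases {n} {K : SetSystem (suc n)} (isMatroid : IsMatroid K) {B : Subset n}
                      (basis : IsBasis K (outside ∷ B)) where
  open MatroidProperties isMatroid

  private
    with-0-dep : ∀ Y → B ⊆ Y → Dep K (inside ∷ Y)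
    with-0-dep Y B⊆Y with K (inside ∷ Y) in indep
    ... | false = refl
    ... | true  = ⊥-elim (basis-maximal _ basis zero refl (indep-⊆ (SubsetP.s⊆s B⊆Y) indep))

    without-0-maximal : ∀ Y → B ⊆ Y → Indep K (outside ∷ Y) → Y ⊆ B
    without-0-maximal Y B⊆Y q = SubsetP.drop-∷-⊆ (proj₂ basis (outside ∷ Y) q (SubsetP.s⊆s B⊆Y))

    not-both : ∀ b Y → B ⊆ Y → Indep (seriesExt K) (inside ∷ b ∷ Y) → b ≡ outside
    not-both true  Y B⊆Y q = ⊥-elim (in-and-out q (with-0-dep Y B⊆Y))
    not-both false Y B⊆Y q = refl

  basis₀ : IsBasis (seriesExt K) (inside ∷ outside ∷ B)
  basis₀ = proj₁ basis , maximal
    where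
    maximal : ∀ Y → Indep (seriesExt K) Y → (inside ∷ outside ∷ B) ⊆ Y → Y ⊆ (inside ∷ outside ∷ B)
    maximal (false ∷ _ ∷ Y) q ⊆Y with use⊆ ⊆Y zero refl
    ... | ()
    maximal (true ∷ b ∷ Y) q ⊆Y with not-both b Y (SubsetP.drop-∷-⊆ (SubsetP.drop-∷-⊆ ⊆Y)) q
    ... | refl = SubsetP.s⊆s (SubsetP.s⊆s (without-0-maximal Y (SubsetP.drop-∷-⊆ (SubsetP.drop-∷-⊆ ⊆Y)) q))

  basis₁ : IsBasis (seriesExt K) (outside ∷ inside ∷ B)
  basis₁ = proj₁ basis , maximal
    where
    maximal : ∀ Y → Indep (seriesExt K) Y → (outside ∷ inside ∷ B) ⊆ Y → Y ⊆ (outside ∷ inside ∷ B)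
    maximal (y ∷ b ∷ Y) q ⊆Y with use⊆ ⊆Y (suc zero) refl
    maximal (true  ∷ .true ∷ Y) q ⊆Y | refl = ⊥-elim (in-and-out q (with-0-dep Y (SubsetP.drop-∷-⊆ (SubsetP.drop-∷-⊆ ⊆Y))))
    maximal (false ∷ .true ∷ Y) q ⊆Y | refl =
      SubsetP.s⊆s (SubsetP.s⊆s (without-0-maximal Y (SubsetP.drop-∷-⊆ (SubsetP.drop-∷-⊆ ⊆Y)) q))

seriesExt-twoCocircuit : ∀ {n} {K : SetSystem (suc n)} → IsMatroid K → NonColoop₀ K →
                         InTwoCocircuit (seriesExt K) zero
seriesExt-twoCocircuit {n} {K} isMatroid nonColoop with nonColoop₀⇒basis isMatroid nonColoop
... | B , basis =
  pair₀₁ , (not-coindep , ⊂pair₀₁-elim _ coindep₀ coindep₁ coindep∅) , In⇒∈ refl , ∣pair₀₁∣ {n}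
  where
  open SeriesExtBases isMatroid basis
  not-coindep : CoIndep (seriesExt K) pair₀₁ → ⊥e
  not-coindep (b₀ ∷ b₁ ∷ B′ , bB′ , pair⊆∁B′) =
    avoiding-both b₀ b₁ (use⊆ pair⊆∁B′ zero refl) (use⊆ pair⊆∁B′ (suc zero) refl) bB′
    where
    avoiding-both : ∀ b₀ b₁ → not b₀ ≡ true → not b₁ ≡ true → IsBasis (seriesExt K) (b₀ ∷ b₁ ∷ B′) → ⊥e
    avoiding-both false false _ _ (q , maximal) =
      true≢false (sym (use⊆ (maximal (inside ∷ outside ∷ B′) q (SubsetP.out⊆ SubsetP.⊆-refl)) zero refl))
  coindep₀ : CoIndep (seriesExt K) (inside ∷ outside ∷ ∅)
  coindep₀ = outside ∷ inside ∷ B , basis₁ , SubsetP.in⊆in (SubsetP.out⊆ (SubsetP.⊆-min _))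
  coindep₁ : CoIndep (seriesExt K) (outside ∷ inside ∷ ∅)
  coindep₁ = inside ∷ outside ∷ B , basis₀ , SubsetP.out⊆ (SubsetP.in⊆in (SubsetP.⊆-min _))
  coindep∅ : CoIndep (seriesExt K) ∅
  coindep∅ = inside ∷ outside ∷ B , basis₀ , SubsetP.⊆-min _

seriesExt-／₀ : ∀ {n} {K : SetSystem (suc n)} → IsMatroid K → (seriesExt K ／ zero) ≅ K
seriesExt-／₀ {K = K} isMatroid = ≗⇒≅ contracted
  where
  contracted : ∀ X → (seriesExt K ／ zero) X ≡ K X
  contracted (b ∷ X) rewrite IsMatroid.empty-indep isMatroid = refl

-- Normal position of parallel and series pairs

insertAt-[]≔-same : ∀ {n} (W : Subset n) i x a → insertAt W i x [ i ]≔ a ≡ insertAt W i a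
insertAt-[]≔-same W       zero    x a = refl
insertAt-[]≔-same (w ∷ W) (suc i) x a = cong (w ∷_) (insertAt-[]≔-same W i x a)

insertAt-[]≔-punchIn : ∀ {n} (W : Subset n) i x j b → insertAt W i x [ punchIn i j ]≔ b ≡ insertAt (W [ j ]≔ b) i x
insertAt-[]≔-punchIn W       zero    x j       b = refl
insertAt-[]≔-punchIn (w ∷ W) (suc i) x zero    b = refl
insertAt-[]≔-punchIn (w ∷ W) (suc i) x (suc j) b = cong (w ∷_) (insertAt-[]≔-punchIn W i x j b)

insertAt-∅ : ∀ {n} (i : Fin (suc n)) → insertAt (∅ {n}) i outside ≡ ∅
insertAt-∅         zero    = refl
insertAt-∅ {suc n} (suc i) = cong (outside ∷_) (insertAt-∅ i)

insertAt₂ : ∀ {n} → Fin (suc (suc n)) → Fin (suc n) → Subset n → Side → Side → Subset (suc (suc n))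
insertAt₂ e s′ X x y = insertAt (insertAt X s′ y) e x

module _ {n} (e : Fin (suc (suc n))) (s′ : Fin (suc n)) where

  lookup-insertAt₂-first : ∀ X x y → lookup (insertAt₂ e s′ X x y) e ≡ x
  lookup-insertAt₂-first X x y = VecP.insertAt-lookup _ e x

  lookup-insertAt₂-second : ∀ X x y → lookup (insertAt₂ e s′ X x y) (punchIn e s′) ≡ y
  lookup-insertAt₂-second X x y = trans (VecP.insertAt-punchIn _ e x s′) (VecP.insertAt-lookup X s′ y)

  insertAt₂-[]≔-first : ∀ X x y a → insertAt₂ e s′ X x y [ e ]≔ a ≡ insertAt₂ e s′ X a y
  insertAt₂-[]≔-first X x y a = insertAt-[]≔-same _ e x a

  insertAt₂-[]≔-second : ∀ X x y b → insertAt₂ e s′ X x y [ punchIn e s′ ]≔ b ≡ insertAt₂ e s′ X x b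
  insertAt₂-[]≔-second X x y b =
    trans (insertAt-[]≔-punchIn _ e x s′ b) (cong (λ W → insertAt W e x) (insertAt-[]≔-same X s′ y b))

  insertAt₂-surjective : ∀ Z → ∃ λ X → Z ≡ insertAt₂ e s′ X (lookup Z e) (lookup Z (punchIn e s′))
  insertAt₂-surjective Z =
    removeAt W s′ , sym (trans (cong (λ V → insertAt V e (lookup Z e)) reinsert) (VecP.insertAt-removeAt Z e))
    where
    W = removeAt Z e
    reinsert : insertAt (removeAt W s′) s′ (lookup Z (punchIn e s′)) ≡ W
    reinsert = trans (cong (insertAt (removeAt W s′) s′) (sym lookup-W)) (VecP.insertAt-removeAt W s′)
      where
      lookup-W : lookup W s′ ≡ lookup Z (punchIn e s′)
      lookup-W = trans (cong (lookup W) (sym (FinP.punchOut-punchIn e)))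
                       (VecP.removeAt-punchOut Z (λ eq → FinP.punchInᵢ≢i e s′ (sym eq)))

  insertAt₂-∅ : insertAt₂ e s′ ∅ outside inside ≡ ∅ [ punchIn e s′ ]≔ inside
  insertAt₂-∅ = sym (trans (cong (_[ punchIn e s′ ]≔ inside) (sym empty)) (insertAt₂-[]≔-second ∅ outside outside inside))
    where
    empty : insertAt₂ e s′ ∅ outside outside ≡ ∅
    empty = trans (cong (λ W → insertAt W e outside) (insertAt-∅ s′)) (insertAt-∅ e)

  -- Relabelling that moves e to position 0 and punchIn e s′ to position 1.
  pairToFront : SetSystem (suc (suc n)) → SetSystem (suc (suc n))
  pairToFront N = toFront (suc zero) (toFront (suc s′) (toFront e N))

  ≅-pairToFront : ∀ N → N ≅ pairToFront N
  ≅-pairToFront N =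
    ≅-trans {S = N₁} {T = N₃} (≅-toFront e N) (≅-trans {S = N₂} {T = N₃} (≅-toFront (suc s′) N₁) (≅-toFront (suc zero) N₂))
    where
    N₁ = toFront e N
    N₂ = toFront (suc s′) N₁
    N₃ = pairToFront N

  module _ {N : SetSystem (suc (suc n))} (isMatroid : IsMatroid N) where
    open MatroidProperties isMatroid

    private
      s = punchIn e s′

    pairToFront-parallelExt : ParallelPair N e s → pairToFront N ≅ parallelExt (toFront s′ (N ∖ e))
    pairToFront-parallelExt pair = ≗⇒≅ pointwise
      where
      pointwise : ∀ Z → pairToFront N Z ≡ parallelExt (toFront s′ (N ∖ e)) Z
      pointwise (true ∷ true ∷ X) =
        ParallelPair.dependent pair _ (lookup-insertAt₂-first X true true) (lookup-insertAt₂-second X true true)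
      pointwise (true ∷ false ∷ X) =
        trans (parallel-replace pair (insertAt₂ e s′ X true false)
                 (lookup-insertAt₂-first X true false) (lookup-insertAt₂-second X true false))
              (cong N (trans (cong (_[ s ]≔ inside) (insertAt₂-[]≔-first X true false false))
                             (insertAt₂-[]≔-second X false false true)))
      pointwise (false ∷ b ∷ X) = refl

    parallel-partner-nonLoop : ParallelPair N e s → NonLoop₀ (toFront s′ (N ∖ e))
    parallel-partner-nonLoop pair = trans (cong N insertAt₂-∅) (ParallelPair.p-indep pair)

    module _ (pair : SeriesPair N e s) where
      private
        module S = Series pair
        module S⁻¹ = Series (SeriesPair-sym pair)

        e-nonLoop : N ⁅ e ⁆ ≡ true
        e-nonLoop = trans (cong N (⁅⁆≡∅[]≔ e))
                          (S.add ∅ (lookup-∅ e) (lookup-∅ s) (IsMatroid.empty-indep isMatroid))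

        contracted : ∀ y X → toFront s′ (N ／ e) (y ∷ X) ≡ N (insertAt₂ e s′ X inside y)
        contracted y X with N ⁅ e ⁆ | e-nonLoop
        ... | true | refl = refl

      pairToFront-seriesExt : pairToFront N ≅ seriesExt (toFront s′ (N ／ e))
      pairToFront-seriesExt = ≗⇒≅ pointwise
        where
        V = insertAt₂ e s′
        pointwise : ∀ Z → pairToFront N Z ≡ seriesExt (toFront s′ (N ／ e)) Z
        pointwise (true ∷ y ∷ X) = sym (contracted y X)
        pointwise (false ∷ false ∷ X) = trans (Bool-ext add-e drop-e) (sym (contracted false X))
          where
          add-e : Indep N (V X false false) → Indep N (V X true false)
          add-e q = subst (Indep N) (insertAt₂-[]≔-first X false false true)
                      (S.add _ (lookup-insertAt₂-first X false false) (lookup-insertAt₂-second X false false) q)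
          drop-e : Indep N (V X true false) → Indep N (V X false false)
          drop-e = indep-⊆ (subst (_⊆ V X true false) (insertAt₂-[]≔-first X true false false) ([]≔outside-⊆ _ e))
        pointwise (false ∷ true ∷ X) = trans (Bool-ext s-to-e e-to-s) (sym (contracted false X))
          where
          s-to-e : Indep N (V X false true) → Indep N (V X true false)
          s-to-e q = subst (Indep N)
            (trans (cong (_[ e ]≔ inside) (insertAt₂-[]≔-second X false true false)) (insertAt₂-[]≔-first X false false true))
            (S.replace _ (lookup-insertAt₂-first X false true) (lookup-insertAt₂-second X false true) q)
          e-to-s : Indep N (V X true false) → Indep N (V X false true)
          e-to-s q = subst (Indep N)
            (trans (cong (_[ s ]≔ inside) (insertAt₂-[]≔-first X true false false)) (insertAt₂-[]≔-second X false false true))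
            (S⁻¹.replace _ (lookup-insertAt₂-second X true false) (lookup-insertAt₂-first X true false) q)

      -- A basis avoiding s contains e; it stays independent in N / e, but adding s to it does not.
      series-partner-nonColoop : NonColoop₀ (toFront s′ (N ／ e))
      series-partner-nonColoop with SeriesPair.basis-avoiding-second pair
      ... | B , bB , s∉B with insertAt₂-surjective B
      ...   | X , B≡ = X , trans (contracted false X) (subst (Indep N) B≡V (proj₁ bB)) , with-s-dep
        where
        e∈B : In B e
        e∈B with SeriesPair.meets-bases pair B bB
        ... | inj₁ e∈B = e∈B
        ... | inj₂ s∈B = ⊥-elim (in-and-out s∈B s∉B)
        B≡V : B ≡ insertAt₂ e s′ X inside outside
        B≡V = trans B≡ (cong₂ (insertAt₂ e s′ X) e∈B s∉B)
        with-s-dep : Dep (toFront s′ (N ／ e)) (inside ∷ X)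
        with-s-dep rewrite contracted true X with N (insertAt₂ e s′ X inside inside) in indep
        ... | false = refl
        ... | true  = ⊥-elim (basis-maximal B bB s s∉B (subst (Indep N)
                        (sym (trans (cong (_[ s ]≔ inside) B≡V) (insertAt₂-[]≔-second X inside outside inside))) indep))

-- spex in normal form

data NormalSpex (𝐌 : Class) : ∀ {n} → SetSystem n → Set where
  base     : ∀ {n} {M : SetSystem n} → 𝐌 M → NormalSpex 𝐌 M
  iso      : ∀ {m n} {N : SetSystem m} {M : SetSystem n} → N ≅ M → NormalSpex 𝐌 M → NormalSpex 𝐌 N
  parallel : ∀ {n} {K : SetSystem (suc n)} → NormalSpex 𝐌 K → NonLoop₀ K → NormalSpex 𝐌 (parallelExt K)
  series   : ∀ {n} {K : SetSystem (suc n)} → NormalSpex 𝐌 K → NonColoop₀ K → NormalSpex 𝐌 (seriesExt K)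

Fin1-distinct : ∀ {a b : Fin 1} → a ≢ b → ⊥e
Fin1-distinct {zero} {zero} a≢b = a≢b refl

module _ {𝐌 : Class} where

  NormalSpex-isMatroid : IsClassOfMatroids 𝐌 → ∀ {n} {M : SetSystem n} → NormalSpex 𝐌 M → IsMatroid M
  NormalSpex-isMatroid matroids (base m)       = matroids _ m
  NormalSpex-isMatroid matroids (iso N≅M s)    = ≅-isMatroid N≅M (NormalSpex-isMatroid matroids s)
  NormalSpex-isMatroid matroids (parallel s _) = parallelExt-isMatroid (NormalSpex-isMatroid matroids s)
  NormalSpex-isMatroid matroids (series s _)   = seriesExt-isMatroid (NormalSpex-isMatroid matroids s)

  normal⇒spex : IsClassOfMatroids 𝐌 → ∀ {n} {M : SetSystem n} → NormalSpex 𝐌 M → spex 𝐌 M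
  normal⇒spex matroids (base m)    = base m
  normal⇒spex matroids (iso N≅M s) = iso N≅M (normal⇒spex matroids s)
  normal⇒spex matroids (parallel {K = K} s nonLoop) =
    par (parallelExt K) zero (parallelExt-isMatroid isMatroid) (parallelExt-twoCircuit isMatroid nonLoop)
        (parallelExt-∖₀ K) (normal⇒spex matroids s)
    where isMatroid = NormalSpex-isMatroid matroids s
  normal⇒spex matroids (series {K = K} s nonColoop) =
    ser (seriesExt K) zero (seriesExt-isMatroid isMatroid) (seriesExt-twoCocircuit isMatroid nonColoop)
        (seriesExt-／₀ isMatroid) (normal⇒spex matroids s)
    where isMatroid = NormalSpex-isMatroid matroids s

  parallelPair-normal : ∀ {n} {N : SetSystem (suc (suc n))} {e p} → IsMatroid N → ParallelPair N e p →
                        NormalSpex 𝐌 (N ∖ e) → NormalSpex 𝐌 N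
  parallelPair-normal {N = N} {e} isMatroid pair s =
    iso (≅-pairToFront e s′ N) (iso (pairToFront-parallelExt e s′ isMatroid pair′)
      (parallel (iso (toFront-≅ s′ (N ∖ e)) s) (parallel-partner-nonLoop e s′ isMatroid pair′)))
    where
    s′ = punchOut (ParallelPair.distinct pair)
    pair′ : ParallelPair N e (punchIn e s′)
    pair′ = subst (ParallelPair N e) (sym (FinP.punchIn-punchOut (ParallelPair.distinct pair))) pair

  seriesPair-normal : ∀ {n} {N : SetSystem (suc (suc n))} {e s} → IsMatroid N → SeriesPair N e s →
                      NormalSpex 𝐌 (N ／ e) → NormalSpex 𝐌 N
  seriesPair-normal {N = N} {e} isMatroid pair s =
    iso (≅-pairToFront e s′ N) (iso (pairToFront-seriesExt e s′ isMatroid pair′)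
      (series (iso (toFront-≅ s′ (N ／ e)) s) (series-partner-nonColoop e s′ isMatroid pair′)))
    where
    s′ = punchOut (SeriesPair.distinct pair)
    pair′ : SeriesPair N e (punchIn e s′)
    pair′ = subst (SeriesPair N e) (sym (FinP.punchIn-punchOut (SeriesPair.distinct pair))) pair

  spex⇒normal : ∀ {n} {M : SetSystem n} → spex 𝐌 M → NormalSpex 𝐌 M
  spex⇒normal (base m)    = base m
  spex⇒normal (iso N≅M s) = iso N≅M (spex⇒normal s)
  spex⇒normal (par {zero} _ _ isMatroid circuit _ _) =
    ⊥-elim (Fin1-distinct (ParallelPair.distinct (proj₂ (twoCircuit⇒parallelPair isMatroid circuit))))
  spex⇒normal (par {suc _} _ _ isMatroid circuit N∖e≅M s) =
    parallelPair-normal isMatroid (proj₂ (twoCircuit⇒parallelPair isMatroid circuit)) (iso N∖e≅M (spex⇒normal s))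
  spex⇒normal (ser {zero} _ _ _ cocircuit _ _) =
    ⊥-elim (Fin1-distinct (SeriesPair.distinct (proj₂ (twoCocircuit⇒seriesPair cocircuit))))
  spex⇒normal (ser {suc _} _ _ isMatroid cocircuit N／e≅M s) =
    seriesPair-normal isMatroid (proj₂ (twoCocircuit⇒seriesPair cocircuit)) (iso N／e≅M (spex⇒normal s))

-- Minors of extensions in normal position

-- A new loop or coloop commutes with the extension once it is moved behind the pair {0, 1}.
⊕loop-parallelExt : ∀ {n} (K : SetSystem (suc n)) →
                    ⊕loop (parallelExt K) ≅ parallelExt (toFront (suc zero) (⊕loop K))
⊕loop-parallelExt K = ≗toFront⇒≅ (suc (suc zero)) (parallelExt L) pointwise
  where
  L = toFront (suc zero) (⊕loop K)
  pointwise : ∀ Z → ⊕loop (parallelExt K) Z ≡ toFront (suc (suc zero)) (parallelExt L) Z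
  pointwise (true  ∷ true  ∷ true  ∷ X) = refl
  pointwise (true  ∷ true  ∷ false ∷ X) = refl
  pointwise (true  ∷ false ∷ y     ∷ X) = refl
  pointwise (false ∷ true  ∷ true  ∷ X) = refl
  pointwise (false ∷ true  ∷ false ∷ X) = refl
  pointwise (false ∷ false ∷ y     ∷ X) = refl

⊕loop-seriesExt : ∀ {n} (K : SetSystem (suc n)) →
                  ⊕loop (seriesExt K) ≅ seriesExt (toFront (suc zero) (⊕loop K))
⊕loop-seriesExt K = ≗toFront⇒≅ (suc (suc zero)) (seriesExt L) pointwise
  where
  L = toFront (suc zero) (⊕loop K)
  pointwise : ∀ Z → ⊕loop (seriesExt K) Z ≡ toFront (suc (suc zero)) (seriesExt L) Z
  pointwise (true  ∷ true  ∷ y ∷ X) = refl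
  pointwise (true  ∷ false ∷ y ∷ X) = refl
  pointwise (false ∷ true  ∷ y ∷ X) = refl
  pointwise (false ∷ false ∷ y ∷ X) = refl

⊕coloop-parallelExt : ∀ {n} (K : SetSystem (suc n)) →
                      ⊕coloop (parallelExt K) ≅ parallelExt (toFront (suc zero) (⊕coloop K))
⊕coloop-parallelExt K = ≗toFront⇒≅ (suc (suc zero)) (parallelExt L) pointwise
  where
  L = toFront (suc zero) (⊕coloop K)
  pointwise : ∀ Z → ⊕coloop (parallelExt K) Z ≡ toFront (suc (suc zero)) (parallelExt L) Z
  pointwise (z ∷ true  ∷ true  ∷ X) = refl
  pointwise (z ∷ true  ∷ false ∷ X) = refl
  pointwise (z ∷ false ∷ y     ∷ X) = refl

⊕coloop-seriesExt : ∀ {n} (K : SetSystem (suc n)) →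
                    ⊕coloop (seriesExt K) ≅ seriesExt (toFront (suc zero) (⊕coloop K))
⊕coloop-seriesExt K = ≗toFront⇒≅ (suc (suc zero)) (seriesExt L) pointwise
  where
  L = toFront (suc zero) (⊕coloop K)
  pointwise : ∀ Z → ⊕coloop (seriesExt K) Z ≡ toFront (suc (suc zero)) (seriesExt L) Z
  pointwise (z ∷ true  ∷ y ∷ X) = refl
  pointwise (z ∷ false ∷ y ∷ X) = refl

parallelExt-of-loop : ∀ {n} {K : SetSystem (suc n)} → IsMatroid K → Dep K (inside ∷ ∅) → parallelExt K ≅ ⊕loop K
parallelExt-of-loop {K = K} isMatroid loop = ≗⇒≅ pointwise
  where
  loop-dep : ∀ X → Dep K (inside ∷ X)
  loop-dep X with K (inside ∷ X) in indep
  ... | false = refl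
  ... | true  = ⊥-elim (in-and-out (IsMatroid.down-closed isMatroid _ _ (SubsetP.s⊆s (SubsetP.⊆-min _)) indep) loop)
  pointwise : ∀ Z → parallelExt K Z ≡ ⊕loop K Z
  pointwise (true  ∷ true  ∷ X) = refl
  pointwise (true  ∷ false ∷ X) = loop-dep X
  pointwise (false ∷ y     ∷ X) = refl

seriesExt-of-coloop : ∀ {n} {K : SetSystem (suc n)} → IsMatroid K → ¬ NonColoop₀ K → seriesExt K ≅ ⊕coloop K
seriesExt-of-coloop {K = K} isMatroid coloop = ≗⇒≅ pointwise
  where
  coloop-free : ∀ X → K (outside ∷ X) ≡ K (inside ∷ X)
  coloop-free X = Bool-ext add-coloop (IsMatroid.down-closed isMatroid _ _ (SubsetP.out⊆ SubsetP.⊆-refl))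
    where
    add-coloop : Indep K (outside ∷ X) → Indep K (inside ∷ X)
    add-coloop q with K (inside ∷ X) in with-0
    ... | true  = refl
    ... | false = ⊥-elim (coloop (X , q , with-0))
  pointwise : ∀ Z → seriesExt K Z ≡ ⊕coloop K Z
  pointwise (true  ∷ y     ∷ X) = refl
  pointwise (false ∷ true  ∷ X) = coloop-free X
  pointwise (false ∷ false ∷ X) = refl

parallelExt-∖₁ : ∀ {n} (K : SetSystem (suc n)) → (parallelExt K ∖ suc zero) ≅ K
parallelExt-∖₁ K = ≗⇒≅ {T = K} λ { (true ∷ X) → refl ; (false ∷ X) → refl }

parallelExt-∖-suc-suc : ∀ {n} (K : SetSystem (suc (suc n))) k → (parallelExt K ∖ suc (suc k)) ≅ parallelExt (K ∖ suc k)
parallelExt-∖-suc-suc K k = ≗⇒≅ {T = parallelExt (K ∖ suc k)} λ { (true ∷ true ∷ X) → refl ; (true ∷ false ∷ X) → refl ; (false ∷ b ∷ X) → refl }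

NonLoop₀-∖ : ∀ {n} {K : SetSystem (suc (suc n))} k → NonLoop₀ K → NonLoop₀ (K ∖ suc k)
NonLoop₀-∖ {K = K} k nonLoop = trans (cong (λ W → K (inside ∷ W)) (insertAt-∅ k)) nonLoop

seriesExt-∖₀ : ∀ {n} (K : SetSystem (suc n)) → (seriesExt K ∖ zero) ≅ ⊕coloop (K ∖ zero)
seriesExt-∖₀ K = ≗⇒≅ {T = ⊕coloop (K ∖ zero)} λ { (b ∷ X) → refl }

seriesExt-∖₁ : ∀ {n} (K : SetSystem (suc n)) → (seriesExt K ∖ suc zero) ≅ ⊕coloop (K ∖ zero)
seriesExt-∖₁ K = ≗⇒≅ {T = ⊕coloop (K ∖ zero)} λ { (true ∷ X) → refl ; (false ∷ X) → refl }

seriesExt-∖-suc-suc : ∀ {n} (K : SetSystem (suc (suc n))) k → (seriesExt K ∖ suc (suc k)) ≅ seriesExt (K ∖ suc k)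
seriesExt-∖-suc-suc K k = ≗⇒≅ {T = seriesExt (K ∖ suc k)} λ { (true ∷ b ∷ X) → refl ; (false ∷ b ∷ X) → refl }

parallelExt-／₀ : ∀ {n} {K : SetSystem (suc n)} → NonLoop₀ K → (parallelExt K ／ zero) ≅ ⊕loop (K ／ zero)
parallelExt-／₀ {K = K} nonLoop = ≗⇒≅ pointwise
  where
  pointwise : ∀ Z → (parallelExt K ／ zero) Z ≡ ⊕loop (K ／ zero) Z
  pointwise (true  ∷ X) rewrite nonLoop = refl
  pointwise (false ∷ X) rewrite nonLoop = refl

parallelExt-／₁ : ∀ {n} {K : SetSystem (suc n)} → NonLoop₀ K → (parallelExt K ／ suc zero) ≅ ⊕loop (K ／ zero)
parallelExt-／₁ {K = K} nonLoop = ≗⇒≅ pointwise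
  where
  pointwise : ∀ Z → (parallelExt K ／ suc zero) Z ≡ ⊕loop (K ／ zero) Z
  pointwise (true  ∷ X) rewrite nonLoop = refl
  pointwise (false ∷ X) rewrite nonLoop = refl

parallelExt-／-suc-suc : ∀ {n} (K : SetSystem (suc (suc n))) k → (parallelExt K ／ suc (suc k)) ≅ parallelExt (K ／ suc k)
parallelExt-／-suc-suc K k = ≗⇒≅ pointwise
  where
  pointwise : ∀ Z → (parallelExt K ／ suc (suc k)) Z ≡ parallelExt (K ／ suc k) Z
  pointwise (true ∷ true ∷ X) with K ⁅ suc k ⁆
  ... | true  = refl
  ... | false = refl
  pointwise (true  ∷ false ∷ X) = refl
  pointwise (false ∷ b     ∷ X) = refl

seriesExt-／₁ : ∀ {n} {K : SetSystem (suc n)} → IsMatroid K → (seriesExt K ／ suc zero) ≅ K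
seriesExt-／₁ {K = K} isMatroid = ≗⇒≅ pointwise
  where
  pointwise : ∀ Z → (seriesExt K ／ suc zero) Z ≡ K Z
  pointwise (true  ∷ X) rewrite IsMatroid.empty-indep isMatroid = refl
  pointwise (false ∷ X) rewrite IsMatroid.empty-indep isMatroid = refl

seriesExt-／-suc-suc : ∀ {n} (K : SetSystem (suc (suc n))) k → (seriesExt K ／ suc (suc k)) ≅ seriesExt (K ／ suc k)
seriesExt-／-suc-suc K k = ≗⇒≅ {T = seriesExt (K ／ suc k)} λ { (true ∷ b ∷ X) → refl ; (false ∷ b ∷ X) → refl }

module Closure {𝐌 : Class} (matroids : IsClassOfMatroids 𝐌) (minor-closed : MinorClosed 𝐌)
               (loop-coloop-closed : LoopColoopClosed 𝐌) where

  normal-⊕loop : ∀ {n} {M : SetSystem n} → NormalSpex 𝐌 M → NormalSpex 𝐌 (⊕loop M)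
  normal-⊕loop (base m)    = base (proj₁ (loop-coloop-closed _ m))
  normal-⊕loop (iso {N = N} {M = M} N≅M s) = iso (⊕loop-resp-≅ {S = N} {T = M} N≅M) (normal-⊕loop s)
  normal-⊕loop (parallel {K = K} s nonLoop) =
    iso (⊕loop-parallelExt K) (parallel (iso (toFront-≅ (suc zero) (⊕loop K)) (normal-⊕loop s)) nonLoop)
  normal-⊕loop (series {K = K} s (X , p , q)) =
    iso (⊕loop-seriesExt K) (series (iso (toFront-≅ (suc zero) (⊕loop K)) (normal-⊕loop s)) (outside ∷ X , p , q))

  normal-⊕coloop : ∀ {n} {M : SetSystem n} → NormalSpex 𝐌 M → NormalSpex 𝐌 (⊕coloop M)
  normal-⊕coloop (base m)    = base (proj₂ (loop-coloop-closed _ m))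
  normal-⊕coloop (iso {N = N} {M = M} N≅M s) = iso (⊕coloop-resp-≅ {S = N} {T = M} N≅M) (normal-⊕coloop s)
  normal-⊕coloop (parallel {K = K} s nonLoop) =
    iso (⊕coloop-parallelExt K) (parallel (iso (toFront-≅ (suc zero) (⊕coloop K)) (normal-⊕coloop s)) nonLoop)
  normal-⊕coloop (series {K = K} s (X , p , q)) =
    iso (⊕coloop-seriesExt K) (series (iso (toFront-≅ (suc zero) (⊕coloop K)) (normal-⊕coloop s)) (outside ∷ X , p , q))

  normal-parallelExt : ∀ {n} {K : SetSystem (suc n)} → NormalSpex 𝐌 K → NormalSpex 𝐌 (parallelExt K)
  normal-parallelExt {K = K} s with K (inside ∷ ∅) in nonLoop?
  ... | true  = parallel s nonLoop?
  ... | false = iso (parallelExt-of-loop (NormalSpex-isMatroid matroids s) nonLoop?) (normal-⊕loop s)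

  normal-seriesExt : ∀ {n} {K : SetSystem (suc n)} → NormalSpex 𝐌 K → NormalSpex 𝐌 (seriesExt K)
  normal-seriesExt {K = K} s with SubsetP.anySubset? (λ X → (K (outside ∷ X) Bool.≟ true) ×-dec (K (inside ∷ X) Bool.≟ false))
  ... | yes nonColoop = series s nonColoop
  ... | no coloop     = iso (seriesExt-of-coloop (NormalSpex-isMatroid matroids s) coloop) (normal-⊕coloop s)

  normal-∖ : ∀ {n} {M : SetSystem (suc n)} → NormalSpex 𝐌 M → ∀ f → NormalSpex 𝐌 (M ∖ f)
  normal-∖ (base m) f = base (minor-closed _ _ (del f (iso ≅-refl)) m)
  normal-∖ (iso {n = zero} N≅M s) f with proj₁ N≅M ⟨$⟩ʳ f
  ... | ()
  normal-∖ (iso {n = suc _} {N = N} {M = M} N≅M s) f with ∖-resp-≅ {S = N} {T = M} N≅M f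
  ... | g , N∖f≅M∖g = iso N∖f≅M∖g (normal-∖ s g)
  normal-∖ (parallel {K = K} s _) zero       = iso (parallelExt-∖₀ K) s
  normal-∖ (parallel {K = K} s _) (suc zero) = iso (parallelExt-∖₁ K) s
  normal-∖ (parallel {n = suc _} {K = K} s nonLoop) (suc (suc k)) =
    iso (parallelExt-∖-suc-suc K k) (parallel (normal-∖ s (suc k)) (NonLoop₀-∖ {K = K} k nonLoop))
  normal-∖ (series {K = K} s _) zero       = iso (seriesExt-∖₀ K) (normal-⊕coloop (normal-∖ s zero))
  normal-∖ (series {K = K} s _) (suc zero) = iso (seriesExt-∖₁ K) (normal-⊕coloop (normal-∖ s zero))
  normal-∖ (series {n = suc _} {K = K} s _) (suc (suc k)) =
    iso (seriesExt-∖-suc-suc K k) (normal-seriesExt (normal-∖ s (suc k)))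

  normal-／ : ∀ {n} {M : SetSystem (suc n)} → NormalSpex 𝐌 M → ∀ f → NormalSpex 𝐌 (M ／ f)
  normal-／ (base m) f = base (minor-closed _ _ (con f (iso ≅-refl)) m)
  normal-／ (iso {n = zero} N≅M s) f with proj₁ N≅M ⟨$⟩ʳ f
  ... | ()
  normal-／ (iso {n = suc _} {N = N} {M = M} N≅M s) f with ／-resp-≅ {S = N} {T = M} N≅M f
  ... | g , N／f≅M／g = iso N／f≅M／g (normal-／ s g)
  normal-／ (parallel s nonLoop) zero       = iso (parallelExt-／₀ nonLoop) (normal-⊕loop (normal-／ s zero))
  normal-／ (parallel s nonLoop) (suc zero) = iso (parallelExt-／₁ nonLoop) (normal-⊕loop (normal-／ s zero))
  normal-／ (parallel {n = suc _} {K = K} s _) (suc (suc k)) =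
    iso (parallelExt-／-suc-suc K k) (normal-parallelExt (normal-／ s (suc k)))
  normal-／ (series s _) zero       = iso (seriesExt-／₀ (NormalSpex-isMatroid matroids s)) s
  normal-／ (series s _) (suc zero) = iso (seriesExt-／₁ (NormalSpex-isMatroid matroids s)) s
  normal-／ (series {n = suc _} {K = K} s _) (suc (suc k)) =
    iso (seriesExt-／-suc-suc K k) (normal-seriesExt (normal-／ s (suc k)))

  normal-minor : ∀ {m n} {N : SetSystem m} {M : SetSystem n} → Minor N M → NormalSpex 𝐌 M → NormalSpex 𝐌 N
  normal-minor (iso N≅M)   s = iso N≅M s
  normal-minor (del e N≤M) s = normal-minor N≤M (normal-∖ s e)
  normal-minor (con e N≤M) s = normal-minor N≤M (normal-／ s e)

lemma3p1 : (𝐌 : Class) → IsClassOfMatroids 𝐌 → MinorClosed 𝐌 → LoopColoopClosed 𝐌 →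
    ∀ {m n} (N : SetSystem m) (M : SetSystem n) → Minor N M → spex 𝐌 M → spex 𝐌 N
lemma3p1 𝐌 matroids minor-closed loop-coloop-closed N M N≤M M∈spex =
  normal⇒spex matroids (normal-minor N≤M (spex⇒normal M∈spex))
  where open Closure matroids minor-closed loop-coloop-closed
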